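{- Let $d\ge 4$ and let $G$ be a near double broom on $n$ vertices with diameter $d$, consisting of a path $v_1,\ldots,v_{d-1}$, $\ell$ leaves adjacent to $v_1$ (one of which is $v_0$), $r$ leaves adjacent to $v_{d-1}$ (one of which is $v_d$), and a singleton leaf $z$ adjacent to $v_k$ with $2\le k\le d-2$. Then $$J(v_0)=4 n^2-11 n-d +9 + \sum_{i=1}^{d-k-1}(2r+2i-1)^2 + \sum_{i=d-k}^{d-2}(2r+2i+1)^2$$ and $$J(v_d)=4 n^2-11 n-d +9 + \sum_{i=1}^{k-1}(2\ell+2i-1)^2 + \sum_{i=k}^{d-2}(2\ell+2i+1)^2.$$
   Context: For a connected graph $G=(V,E)$ and simple random walk on $G$ (each step moves to a uniformly random neighbor), $H(u,v)$ is the expected number of steps for the walk from $u$ to reach $v$, with $H(u,u)=0$; the joining time is $J(v)=\sum_{u\in V}\deg(u)H(u,v)$. A double broom is a tree consisting of a path $v_1,\ldots,v_{d-1}$ with $\ell\ge1$ leaves adjacent to $v_1$ and $r\ge1$ leaves adjacent to $v_{d-1}$. A near double broom is a tree that is not a double broom but has a leaf $z$ (the singleton leaf) whose removal yields a double broom; here $n=\ell+r+d$. -}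

module Defs where

open import Data.Nat as ℕ using (ℕ; zero; suc; _∸_; _≟_)
open import Data.Fin using (Fin; toℕ)
open import Data.Bool using (Bool; true; false; _∨_; if_then_else_)
open import Data.Integer using (+_)
open import Relation.Nullary.Decidable using (⌊_⌋)
open import Data.Rational using (ℚ; _/_; 0ℚ; _+_; _*_; _-_)
open import Relation.Binary.PropositionalEquality using (_≡_)
open import Data.Product using (_×_)
open import Relation.Nullary using (¬_)

ℕ→ℚ : ℕ → ℚ
ℕ→ℚ n = + n / 1

sumFin : (n : ℕ) → (Fin n → ℚ) → ℚ
sumFin zero    f = 0ℚ
sumFin (suc n) f = f Fin.zero + sumFin n (λ i → f (Fin.suc i))
  where import Data.Fin as Fin

sumFrom : ℕ → ℕ → (ℕ → ℚ) → ℚ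
sumFrom a zero    f = 0ℚ
sumFrom a (suc m) f = f a + sumFrom (suc a) m f

-- Σ_{i = a}^{b} f i  (inclusive; empty when b < a)
sumRange : ℕ → ℕ → (ℕ → ℚ) → ℚ
sumRange a b f = sumFrom a (suc b ∸ a) f

-- Vertices: path vertices v_0,…,v_d (v_0 is one of the ℓ leaves at v_1,
-- v_d one of the r leaves at v_{d-1}), the ℓ-1 other left leaves,
-- the r-1 other right leaves, and the singleton leaf z attached to v_k.
-- Total: (d+1) + (ℓ-1) + (r-1) + 1 = ℓ + r + d vertices (for ℓ, r ≥ 1).

data Vtx (ℓ r d : ℕ) : Set where
  pv : Fin (suc d) → Vtx ℓ r d
  lf : Fin (ℓ ∸ 1) → Vtx ℓ r d
  rt : Fin (r ∸ 1) → Vtx ℓ r d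
  zz : Vtx ℓ r d

module NDB (ℓ r d k : ℕ) where

  V : Set
  V = Vtx ℓ r d

  is : ℕ → ℕ → Bool
  is a b = ⌊ a ≟ b ⌋

  adj : V → V → Bool
  adj (pv i) (pv j) = is (toℕ j) (suc (toℕ i)) ∨ is (toℕ i) (suc (toℕ j))
  adj (lf _) (pv j) = is (toℕ j) 1
  adj (pv j) (lf _) = is (toℕ j) 1
  adj (rt _) (pv j) = is (toℕ j) (d ∸ 1)
  adj (pv j) (rt _) = is (toℕ j) (d ∸ 1)
  adj zz     (pv j) = is (toℕ j) k
  adj (pv j) zz     = is (toℕ j) k
  adj _      _      = false

  sumV : (V → ℚ) → ℚ
  sumV f = sumFin (suc d) (λ i → f (pv i))
         + sumFin (ℓ ∸ 1) (λ i → f (lf i))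
         + sumFin (r ∸ 1) (λ i → f (rt i))
         + f zz

  ind : Bool → ℚ
  ind b = if b then ℕ→ℚ 1 else 0ℚ

  sumNbr : V → (V → ℚ) → ℚ
  sumNbr u g = sumV (λ w → ind (adj u w) * g w)

  deg : V → ℚ
  deg u = sumNbr u (λ _ → ℕ→ℚ 1)

  -- H is the hitting-time function of simple random walk:
  -- H(v,v) = 0 and, for u ≠ v, H(u,v) = 1 + (1/deg u) Σ_{w ~ u} H(w,v),
  -- written multiplied through by deg u.
  IsHittingTime : (V → V → ℚ) → Set
  IsHittingTime H = (v : V) →
    (H v v ≡ 0ℚ) × ((u : V) → ¬ (u ≡ v) → deg u * H u v ≡ deg u + sumNbr u (λ w → H w v))

  J : (V → V → ℚ) → V → ℚ
  J H v = sumV (λ u → deg u * H u v)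

{-# OPTIONS --safe #-}
module Submission where

-- In a tree, Σ_{w ∼ u} dist(w, x) = deg u · dist(u, x) + deg u − 2 + 2[u = x]: every
-- neighbour of u is one step farther from x, except the one towards x. This makes Tetali's formula
-- H(u, v) = ½ Σₓ deg x · (dist(u, v) + dist(v, x) − dist(u, x)) a solution of the hitting-time equations.
--
-- Take any solution H and the target v_d. A leaf off the path has H = 1 + H(its neighbour), and
-- along the path the equations telescope to H(v_t) − H(v_{t+1}) = X_t, where X_t is the total degree of
-- the component of v_t after deleting the edge v_t v_{t+1}, counted in the whole tree: twice its number of
-- edges, plus one. Summation by parts turns J(v_d) = Σ_u deg u · H(u, v_d) into Σ_{t<d} X_t² plus the
-- number of leaves off the path, and X_t runs through the odd numbers 1, 2ℓ+1, 2ℓ+3, …, skipping one at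
-- the vertex v_k carrying z, and ends with X_{d−1} = 2n − 3. J(v_0) is the same computation along the
-- reversed path.

open import Defs

-- A module of its own, so that _+_ is addition of rationals here but of naturals in lemma4p4.
module JoiningTimes where

  open import Algebra.Bundles using (CommutativeRing)
  open import Data.Bool using (Bool; true; false; _∨_; if_then_else_)
  open import Data.Empty using (⊥-elim)
  open import Data.Fin using (Fin; zero; suc; toℕ; fromℕ)
  import Data.Fin.Properties as Finₚ
  import Data.Integer as ℤ
  import Data.Integer.Properties as ℤₚ
  open import Data.Nat as ℕ using (ℕ; zero; suc; _≤_; _<_; z≤n; s≤s; _∸_; _≟_; ∣_-_∣)
  import Data.Nat.Coprimality as Coprime
  import Data.Nat.Properties as ℕₚ
  import Data.Nat.Tactic.RingSolver as ℕ-Ring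
  open import Data.Product using (_,_; proj₁; proj₂)
  open import Data.Rational using (ℚ; mkℚ; _/_; 0ℚ; 1ℚ; ½; _+_; _*_; _-_; -_)
  import Data.Rational.Properties as ℚₚ
  open import Data.Sum using (inj₁; inj₂)
  open import Function using (_∘_)
  open import Level using (0ℓ)
  open import Relation.Binary.Definitions using (DecidableEquality; tri<; tri≈; tri>)
  open import Relation.Binary.PropositionalEquality hiding (J)
  open import Relation.Nullary using (yes; no)
  open import Relation.Nullary.Decidable using (⌊_⌋; does; dec⇒maybe; map′)
  open import Tactic.RingSolver using (solve-∀)
  open import Tactic.RingSolver.Core.AlmostCommutativeRing using (AlmostCommutativeRing; fromCommutativeRing)
  open import Algebra.Properties.Semiring.Sum (CommutativeRing.semiring ℚₚ.+-*-commutativeRing)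
    using (sum; ∑-distrib-+; ∑-comm; *-distribˡ-sum)

  ℚ-ring : AlmostCommutativeRing 0ℓ 0ℓ
  ℚ-ring = fromCommutativeRing ℚₚ.+-*-commutativeRing (λ x → dec⇒maybe (0ℚ ℚₚ.≟ x))

  ℕ→ℚ≡mkℚ : ∀ n → ℕ→ℚ n ≡ mkℚ (ℤ.+ n) 0 (Coprime.sym (Coprime.1-coprimeTo n))
  ℕ→ℚ≡mkℚ n = ℚₚ.normalize-coprime (Coprime.sym (Coprime.1-coprimeTo n))

  ℕ→ℚ-+ : ∀ m n → ℕ→ℚ (m ℕ.+ n) ≡ ℕ→ℚ m + ℕ→ℚ n
  ℕ→ℚ-+ m n = sym (begin
    ℕ→ℚ m + ℕ→ℚ n
      ≡⟨ cong₂ _+_ (ℕ→ℚ≡mkℚ m) (ℕ→ℚ≡mkℚ n) ⟩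
    (ℤ.+ m ℤ.* ℤ.+ 1 ℤ.+ ℤ.+ n ℤ.* ℤ.+ 1) / 1
      ≡⟨ cong₂ (λ a b → (a ℤ.+ b) / 1) (ℤₚ.*-identityʳ (ℤ.+ m)) (ℤₚ.*-identityʳ (ℤ.+ n)) ⟩
    ℕ→ℚ (m ℕ.+ n) ∎)
    where open ≡-Reasoning

  ℕ→ℚ-* : ∀ m n → ℕ→ℚ (m ℕ.* n) ≡ ℕ→ℚ m * ℕ→ℚ n
  ℕ→ℚ-* m n = sym (begin
    ℕ→ℚ m * ℕ→ℚ n      ≡⟨ cong₂ _*_ (ℕ→ℚ≡mkℚ m) (ℕ→ℚ≡mkℚ n) ⟩
    (ℤ.+ m ℤ.* ℤ.+ n) / 1  ≡⟨ cong (_/ 1) (sym (ℤₚ.pos-* m n)) ⟩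
    ℕ→ℚ (m ℕ.* n)      ∎)
    where open ≡-Reasoning

  ℕ→ℚ-suc : ∀ n → ℕ→ℚ (suc n) ≡ ℕ→ℚ 1 + ℕ→ℚ n
  ℕ→ℚ-suc = ℕ→ℚ-+ 1

  ℕ→ℚ-+₃ : ∀ a b c → ℕ→ℚ (a ℕ.+ b ℕ.+ c) ≡ ℕ→ℚ a + ℕ→ℚ b + ℕ→ℚ c
  ℕ→ℚ-+₃ a b c = trans (ℕ→ℚ-+ (a ℕ.+ b) c) (cong (_+ ℕ→ℚ c) (ℕ→ℚ-+ a b))

  ℕ→ℚ-sub : ∀ x y z → x ℕ.+ z ≡ y → ℕ→ℚ x ≡ ℕ→ℚ y - ℕ→ℚ z
  ℕ→ℚ-sub x _ z refl = begin
    ℕ→ℚ x                           ≡⟨ lemma (ℕ→ℚ x) (ℕ→ℚ z) ⟩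
    (ℕ→ℚ x + ℕ→ℚ z) - ℕ→ℚ z         ≡⟨ cong (_- ℕ→ℚ z) (sym (ℕ→ℚ-+ x z)) ⟩
    ℕ→ℚ (x ℕ.+ z) - ℕ→ℚ z           ∎
    where
    open ≡-Reasoning
    lemma : ∀ a b → a ≡ (a + b) - b
    lemma = solve-∀ ℚ-ring

  ℕ→ℚ-square : ∀ {q} x → q ≡ ℕ→ℚ x → q * q ≡ ℕ→ℚ (x ℕ.* x)
  ℕ→ℚ-square x refl = sym (ℕ→ℚ-* x x)

  -- Indicators of ℕ-equations are written ⌊ m ≟ n ⌋, as in Defs, so that they match NDB.adj and NDB.ind.
  𝟙 : Bool → ℚ
  𝟙 b = if b then ℕ→ℚ 1 else 0ℚ

  +-cong₄ : ∀ {a b c e a′ b′ c′ e′ : ℚ} → a ≡ a′ → b ≡ b′ → c ≡ c′ → e ≡ e′ → a + b + c + e ≡ a′ + b′ + c′ + e′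
  +-cong₄ refl refl refl refl = refl

  𝟙-false : ∀ x → 𝟙 false * x ≡ 0ℚ
  𝟙-false = ℚₚ.*-zeroˡ

  𝟙-true : ∀ x → 𝟙 true * x ≡ x
  𝟙-true = ℚₚ.*-identityˡ

  ≟-refl : ∀ n → ⌊ n ≟ n ⌋ ≡ true
  ≟-refl n with n ≟ n
  ... | yes _  = refl
  ... | no n≢n = ⊥-elim (n≢n refl)

  ≢⇒≟-false : ∀ {m n} → m ≢ n → ⌊ m ≟ n ⌋ ≡ false
  ≢⇒≟-false {m} {n} m≢n with m ≟ n
  ... | yes m≡n = ⊥-elim (m≢n m≡n)
  ... | no _    = refl

  ≟-suc : ∀ m n → ⌊ suc m ≟ suc n ⌋ ≡ ⌊ m ≟ n ⌋
  ≟-suc m n with m ≟ n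
  ... | yes refl = ≟-refl (suc m)
  ... | no m≢n   = ≢⇒≟-false (m≢n ∘ ℕₚ.suc-injective)

  ≟-comm : ∀ m n → ⌊ m ≟ n ⌋ ≡ ⌊ n ≟ m ⌋
  ≟-comm m n with m ≟ n
  ... | yes refl = sym (≟-refl m)
  ... | no m≢n   = sym (≢⇒≟-false (m≢n ∘ sym))

  𝟙-≟-subst : ∀ m n (f : ℕ → ℚ) → 𝟙 ⌊ m ≟ n ⌋ * f n ≡ 𝟙 ⌊ m ≟ n ⌋ * f m
  𝟙-≟-subst m n f with m ≟ n
  ... | yes refl = refl
  ... | no _     = trans (𝟙-false (f n)) (sym (𝟙-false (f m)))

  sumFin≡sum : ∀ n (f : Fin n → ℚ) → sumFin n f ≡ sum f
  sumFin≡sum zero    f = refl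
  sumFin≡sum (suc n) f = cong (f zero +_) (sumFin≡sum n (f ∘ suc))

  sumFin-cong : ∀ n {f g : Fin n → ℚ} → (∀ i → f i ≡ g i) → sumFin n f ≡ sumFin n g
  sumFin-cong zero    f≗g = refl
  sumFin-cong (suc n) f≗g = cong₂ _+_ (f≗g zero) (sumFin-cong n (f≗g ∘ suc))

  sumFin-+ : ∀ n (f g : Fin n → ℚ) → sumFin n (λ i → f i + g i) ≡ sumFin n f + sumFin n g
  sumFin-+ n f g = begin
    sumFin n (λ i → f i + g i)  ≡⟨ sumFin≡sum n _ ⟩
    sum (λ i → f i + g i)       ≡⟨ ∑-distrib-+ f g ⟩
    sum f + sum g               ≡⟨ sym (cong₂ _+_ (sumFin≡sum n f) (sumFin≡sum n g)) ⟩
    sumFin n f + sumFin n g     ∎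
    where open ≡-Reasoning

  sumFin-*ˡ : ∀ n c (f : Fin n → ℚ) → sumFin n (λ i → c * f i) ≡ c * sumFin n f
  sumFin-*ˡ n c f = begin
    sumFin n (λ i → c * f i)  ≡⟨ sumFin≡sum n _ ⟩
    sum (λ i → c * f i)       ≡⟨ sym (*-distribˡ-sum c f) ⟩
    c * sum f                 ≡⟨ cong (c *_) (sym (sumFin≡sum n f)) ⟩
    c * sumFin n f            ∎
    where open ≡-Reasoning

  sumFin-comm : ∀ m n (A : Fin m → Fin n → ℚ) →
    sumFin m (λ i → sumFin n (A i)) ≡ sumFin n (λ j → sumFin m (λ i → A i j))
  sumFin-comm m n A = begin
    sumFin m (λ i → sumFin n (A i))         ≡⟨ sumFin-cong m (λ i → sumFin≡sum n (A i)) ⟩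
    sumFin m (λ i → sum (A i))              ≡⟨ sumFin≡sum m _ ⟩
    sum (λ i → sum (A i))                   ≡⟨ ∑-comm A ⟩
    sum (λ j → sum (λ i → A i j))           ≡⟨ sym (sumFin≡sum n _) ⟩
    sumFin n (λ j → sum (λ i → A i j))      ≡⟨ sumFin-cong n (λ j → sym (sumFin≡sum m (λ i → A i j))) ⟩
    sumFin n (λ j → sumFin m (λ i → A i j)) ∎
    where open ≡-Reasoning

  sumFin-const : ∀ n c → sumFin n (λ _ → c) ≡ ℕ→ℚ n * c
  sumFin-const zero    c = sym (ℚₚ.*-zeroˡ c)
  sumFin-const (suc n) c = begin
    c + sumFin n (λ _ → c)    ≡⟨ cong (c +_) (sumFin-const n c) ⟩
    c + ℕ→ℚ n * c             ≡⟨ lemma c (ℕ→ℚ n) ⟩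
    (ℕ→ℚ 1 + ℕ→ℚ n) * c       ≡⟨ cong (_* c) (sym (ℕ→ℚ-suc n)) ⟩
    ℕ→ℚ (suc n) * c           ∎
    where
    open ≡-Reasoning
    lemma : ∀ c m → c + m * c ≡ (ℕ→ℚ 1 + m) * c
    lemma = solve-∀ ℚ-ring

  sumFin-zero : ∀ n → sumFin n (λ _ → 0ℚ) ≡ 0ℚ
  sumFin-zero n = trans (sumFin-const n 0ℚ) (ℚₚ.*-zeroʳ (ℕ→ℚ n))

  sumFin-𝟙-false : ∀ n (f : Fin n → ℚ) → sumFin n (λ i → 𝟙 false * f i) ≡ 0ℚ
  sumFin-𝟙-false n f = trans (sumFin-cong n (𝟙-false ∘ f)) (sumFin-zero n)

  sumFin-select : ∀ n (j : Fin n) (f : Fin n → ℚ) → sumFin n (λ i → 𝟙 (does (i Finₚ.≟ j)) * f i) ≡ f j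
  sumFin-select (suc n) zero    f = begin
    𝟙 true * f zero + sumFin n (λ i → 𝟙 false * f (suc i))
      ≡⟨ cong₂ _+_ (𝟙-true (f zero)) (sumFin-𝟙-false n (f ∘ suc)) ⟩
    f zero + 0ℚ  ≡⟨ ℚₚ.+-identityʳ _ ⟩
    f zero       ∎
    where open ≡-Reasoning
  sumFin-select (suc n) (suc j) f =
    trans (cong₂ _+_ (𝟙-false (f zero)) (sumFin-select n j (f ∘ suc))) (ℚₚ.+-identityˡ (f (suc j)))

  sumFrom-cong : ∀ a n {f g : ℕ → ℚ} → (∀ s → s < n → f (a ℕ.+ s) ≡ g (a ℕ.+ s)) → sumFrom a n f ≡ sumFrom a n g
  sumFrom-cong a zero    f≗g = refl
  sumFrom-cong a (suc n) {f} {g} f≗g = cong₂ _+_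
    (subst (λ i → f i ≡ g i) (ℕₚ.+-identityʳ a) (f≗g 0 (s≤s z≤n)))
    (sumFrom-cong (suc a) n (λ s s<n → subst (λ i → f i ≡ g i) (ℕₚ.+-suc a s) (f≗g (suc s) (s≤s s<n))))

  sumFrom-+ : ∀ a n (f g : ℕ → ℚ) → sumFrom a n (λ i → f i + g i) ≡ sumFrom a n f + sumFrom a n g
  sumFrom-+ a zero    f g = sym (ℚₚ.+-identityˡ 0ℚ)
  sumFrom-+ a (suc n) f g = trans (cong (f a + g a +_) (sumFrom-+ (suc a) n f g)) (lemma (f a) (g a) (sumFrom (suc a) n f) (sumFrom (suc a) n g))
    where
    lemma : ∀ a b c d → (a + b) + (c + d) ≡ (a + c) + (b + d)
    lemma = solve-∀ ℚ-ring

  sumFrom-zero : ∀ a n → sumFrom a n (λ _ → 0ℚ) ≡ 0ℚ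
  sumFrom-zero a zero    = refl
  sumFrom-zero a (suc n) = trans (ℚₚ.+-identityˡ _) (sumFrom-zero (suc a) n)

  sumFrom-++ : ∀ a m n (f : ℕ → ℚ) → sumFrom a (m ℕ.+ n) f ≡ sumFrom a m f + sumFrom (a ℕ.+ m) n f
  sumFrom-++ a zero    n f = trans (cong (λ b → sumFrom b n f) (sym (ℕₚ.+-identityʳ a))) (sym (ℚₚ.+-identityˡ _))
  sumFrom-++ a (suc m) n f = begin
    f a + sumFrom (suc a) (m ℕ.+ n) f
      ≡⟨ cong (f a +_) (sumFrom-++ (suc a) m n f) ⟩
    f a + (sumFrom (suc a) m f + sumFrom (suc a ℕ.+ m) n f)
      ≡⟨ sym (ℚₚ.+-assoc (f a) _ _) ⟩
    f a + sumFrom (suc a) m f + sumFrom (suc a ℕ.+ m) n f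
      ≡⟨ cong (λ b → sumFrom a (suc m) f + sumFrom b n f) (sym (ℕₚ.+-suc a m)) ⟩
    sumFrom a (suc m) f + sumFrom (a ℕ.+ suc m) n f ∎
    where open ≡-Reasoning

  sumFrom-snoc : ∀ a n (f : ℕ → ℚ) → sumFrom a (suc n) f ≡ sumFrom a n f + f (a ℕ.+ n)
  sumFrom-snoc a n f = begin
    sumFrom a (suc n) f                        ≡⟨ cong (λ m → sumFrom a m f) (ℕₚ.+-comm 1 n) ⟩
    sumFrom a (n ℕ.+ 1) f                      ≡⟨ sumFrom-++ a n 1 f ⟩
    sumFrom a n f + (f (a ℕ.+ n) + 0ℚ)         ≡⟨ cong (sumFrom a n f +_) (ℚₚ.+-identityʳ _) ⟩
    sumFrom a n f + f (a ℕ.+ n)                ∎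
    where open ≡-Reasoning

  sumFrom-shift : ∀ a n (f : ℕ → ℚ) → sumFrom a n (f ∘ suc) ≡ sumFrom (suc a) n f
  sumFrom-shift a zero    f = refl
  sumFrom-shift a (suc n) f = cong (f (suc a) +_) (sumFrom-shift (suc a) n f)

  sumFin≡sumFrom : ∀ n (f : ℕ → ℚ) → sumFin n (f ∘ toℕ) ≡ sumFrom 0 n f
  sumFin≡sumFrom zero    f = refl
  sumFin≡sumFrom (suc n) f = cong (f 0 +_) (trans (sumFin≡sumFrom n (f ∘ suc)) (sumFrom-shift 0 n f))

  sumFrom-select-∉ : ∀ a n c (f : ℕ → ℚ) → (∀ s → s < n → a ℕ.+ s ≢ c) →
    sumFrom a n (λ i → 𝟙 ⌊ i ≟ c ⌋ * f i) ≡ 0ℚ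
  sumFrom-select-∉ a n c f c∉ = trans
    (sumFrom-cong a n (λ s s<n → trans (cong (λ b → 𝟙 b * f (a ℕ.+ s)) (≢⇒≟-false (c∉ s s<n))) (𝟙-false (f (a ℕ.+ s)))))
    (sumFrom-zero a n)

  sumFrom-select : ∀ a n c (f : ℕ → ℚ) → a ≤ c → c < a ℕ.+ n → sumFrom a n (λ i → 𝟙 ⌊ i ≟ c ⌋ * f i) ≡ f c
  sumFrom-select a zero    c f a≤c c<a+0 =
    ⊥-elim (ℕₚ.<-irrefl refl (ℕₚ.<-≤-trans (subst (c <_) (ℕₚ.+-identityʳ a) c<a+0) a≤c))
  sumFrom-select a (suc n) c f a≤c c<a+1+n with a ≟ c
  ... | yes refl = trans (cong₂ _+_ (𝟙-true (f a))
                                    (sumFrom-select-∉ (suc a) n a f (λ s _ 1+a+s≡a → ℕₚ.<-irrefl (sym 1+a+s≡a) (s≤s (ℕₚ.m≤m+n a s)))))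
                         (ℚₚ.+-identityʳ (f a))
  ... | no a≢c   = trans (cong₂ _+_ (𝟙-false (f a))
                                    (sumFrom-select (suc a) n c f (ℕₚ.≤∧≢⇒< a≤c a≢c) (subst (c <_) (ℕₚ.+-suc a n) c<a+1+n)))
                         (ℚₚ.+-identityˡ (f c))

  sumFrom-reverse : ∀ n (f : ℕ → ℚ) → sumFrom 0 (suc n) f ≡ sumFrom 0 (suc n) (λ t → f (n ∸ t))
  sumFrom-reverse zero    f = refl
  sumFrom-reverse (suc n) f = begin
    f 0 + sumFrom 1 (suc n) f
      ≡⟨ cong (f 0 +_) (sym (sumFrom-shift 0 (suc n) f)) ⟩
    f 0 + sumFrom 0 (suc n) (f ∘ suc)
      ≡⟨ cong (f 0 +_) (sumFrom-reverse n (f ∘ suc)) ⟩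
    f 0 + sumFrom 0 (suc n) (λ t → f (suc (n ∸ t)))
      ≡⟨ cong (f 0 +_) (sumFrom-cong 0 (suc n) (λ t t≤n → cong f (sym (ℕₚ.+-∸-assoc 1 (ℕₚ.≤-pred t≤n))))) ⟩
    f 0 + sumFrom 0 (suc n) (λ t → f (suc n ∸ t))
      ≡⟨ ℚₚ.+-comm (f 0) _ ⟩
    sumFrom 0 (suc n) (λ t → f (suc n ∸ t)) + f 0
      ≡⟨ cong (λ m → sumFrom 0 (suc n) (λ t → f (suc n ∸ t)) + f m) (sym (ℕₚ.n∸n≡0 n)) ⟩
    sumFrom 0 (suc n) (λ t → f (suc n ∸ t)) + f (n ∸ n)
      ≡⟨ sym (sumFrom-snoc 0 (suc n) (λ t → f (suc n ∸ t))) ⟩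
    sumFrom 0 (suc (suc n)) (λ t → f (suc n ∸ t)) ∎
    where open ≡-Reasoning

  -- Hitting times along a path, and summation by parts
  partialSum : (ℕ → ℚ) → ℕ → ℚ
  partialSum M zero    = M 0
  partialSum M (suc t) = partialSum M t + M (suc t)

  module _ (M G : ℕ → ℚ) (N : ℕ) (gap : ∀ t → t < N → G t ≡ G (suc t) + partialSum M t) where
    private
      X : ℕ → ℚ
      X = partialSum M

      sumFrom-*-partial : ∀ n → n ≤ N → sumFrom 0 (suc n) (λ t → M t * G t) ≡ sumFrom 0 n (λ t → X t * X t) + X n * G n
      sumFrom-*-partial zero    _   = trans (ℚₚ.+-identityʳ (M 0 * G 0)) (sym (ℚₚ.+-identityˡ (X 0 * G 0)))
      sumFrom-*-partial (suc n) n<N = begin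
        sumFrom 0 (suc (suc n)) (λ t → M t * G t)
          ≡⟨ sumFrom-snoc 0 (suc n) (λ t → M t * G t) ⟩
        sumFrom 0 (suc n) (λ t → M t * G t) + M (suc n) * G (suc n)
          ≡⟨ cong (_+ M (suc n) * G (suc n)) (sumFrom-*-partial n (ℕₚ.<⇒≤ n<N)) ⟩
        ΣX² + X n * G n + M (suc n) * G (suc n)
          ≡⟨ cong (λ y → ΣX² + X n * y + M (suc n) * G (suc n)) (gap n n<N) ⟩
        ΣX² + X n * (G (suc n) + X n) + M (suc n) * G (suc n)
          ≡⟨ lemma ΣX² (X n) (G (suc n)) (M (suc n)) ⟩
        (ΣX² + X n * X n) + X (suc n) * G (suc n)
          ≡⟨ cong (_+ X (suc n) * G (suc n)) (sym (sumFrom-snoc 0 n (λ t → X t * X t))) ⟩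
        sumFrom 0 (suc n) (λ t → X t * X t) + X (suc n) * G (suc n) ∎
        where
        open ≡-Reasoning
        ΣX² = sumFrom 0 n (λ t → X t * X t)
        lemma : ∀ s x g m → s + x * (g + x) + m * g ≡ (s + x * x) + (x + m) * g
        lemma = solve-∀ ℚ-ring

    summation-by-parts : G N ≡ 0ℚ → sumFrom 0 (suc N) (λ t → M t * G t) ≡ sumFrom 0 N (λ t → X t * X t)
    summation-by-parts G[N]≡0 = begin
      sumFrom 0 (suc N) (λ t → M t * G t)                 ≡⟨ sumFrom-*-partial N ℕₚ.≤-refl ⟩
      sumFrom 0 N (λ t → X t * X t) + X N * G N           ≡⟨ cong (λ y → sumFrom 0 N (λ t → X t * X t) + X N * y) G[N]≡0 ⟩
      sumFrom 0 N (λ t → X t * X t) + X N * 0ℚ            ≡⟨ cong (sumFrom 0 N (λ t → X t * X t) +_) (ℚₚ.*-zeroʳ (X N)) ⟩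
      sumFrom 0 N (λ t → X t * X t) + 0ℚ                  ≡⟨ ℚₚ.+-identityʳ _ ⟩
      sumFrom 0 N (λ t → X t * X t)                       ∎
      where open ≡-Reasoning

  -- On a path v₀ v₁ … whose vertex v_t carries c t pendant leaves, pathWeight c t is the degree of v_t plus
  -- those of its pendant leaves. In hittingTime-gaps, g t is the hitting time from v_t to a target at or
  -- beyond v_N, a pendant leaf at v_t having hitting time 1 + g t.
  pathWeight : (ℕ → ℚ) → ℕ → ℚ
  pathWeight c zero    = 1ℚ + ℕ→ℚ 2 * c 0
  pathWeight c (suc t) = ℕ→ℚ 2 + ℕ→ℚ 2 * c (suc t)

  hittingTime-gaps : ∀ (c g : ℕ → ℚ) N →
    (1ℚ + c 0) * g 0 ≡ (1ℚ + c 0) + (g 1 + c 0 * (1ℚ + g 0)) →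
    (∀ t → suc t < N → (ℕ→ℚ 2 + c (suc t)) * g (suc t)
                        ≡ (ℕ→ℚ 2 + c (suc t)) + (g (suc (suc t)) + g t + c (suc t) * (1ℚ + g (suc t)))) →
    ∀ t → t < N → g t ≡ g (suc t) + partialSum (pathWeight c) t
  hittingTime-gaps c g N end interior zero    _   = begin
    g 0                                                     ≡⟨ lemma₁ (c 0) (g 0) ⟩
    (1ℚ + c 0) * g 0 - c 0 * g 0                            ≡⟨ cong (_- c 0 * g 0) end ⟩
    (1ℚ + c 0) + (g 1 + c 0 * (1ℚ + g 0)) - c 0 * g 0       ≡⟨ lemma₂ (c 0) (g 0) (g 1) ⟩
    g 1 + (1ℚ + ℕ→ℚ 2 * c 0)                                ∎
    where
    open ≡-Reasoning
    lemma₁ : ∀ c y → y ≡ (1ℚ + c) * y - c * y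
    lemma₁ = solve-∀ ℚ-ring
    lemma₂ : ∀ c y z → (1ℚ + c) + (z + c * (1ℚ + y)) - c * y ≡ z + (1ℚ + ℕ→ℚ 2 * c)
    lemma₂ = solve-∀ ℚ-ring
  hittingTime-gaps c g N end interior (suc t) 1+t<N = begin
    y                                                              ≡⟨ lemma₁ (c (suc t)) y ⟩
    (ℕ→ℚ 2 + c (suc t)) * y - (1ℚ + c (suc t)) * y                 ≡⟨ cong (_- (1ℚ + c (suc t)) * y) (interior t 1+t<N) ⟩
    (ℕ→ℚ 2 + c (suc t)) + (z + g t + c (suc t) * (1ℚ + y)) - (1ℚ + c (suc t)) * y
      ≡⟨ cong (λ w → (ℕ→ℚ 2 + c (suc t)) + (z + w + c (suc t) * (1ℚ + y)) - (1ℚ + c (suc t)) * y) previous ⟩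
    (ℕ→ℚ 2 + c (suc t)) + (z + (y + x) + c (suc t) * (1ℚ + y)) - (1ℚ + c (suc t)) * y
      ≡⟨ lemma₂ (c (suc t)) y z x ⟩
    z + (x + (ℕ→ℚ 2 + ℕ→ℚ 2 * c (suc t)))                        ∎
    where
    open ≡-Reasoning
    y = g (suc t)
    z = g (suc (suc t))
    x = partialSum (pathWeight c) t
    previous : g t ≡ y + x
    previous = hittingTime-gaps c g N end interior t (ℕₚ.<-trans (ℕₚ.n<1+n t) 1+t<N)
    lemma₁ : ∀ c y → y ≡ (ℕ→ℚ 2 + c) * y - (1ℚ + c) * y
    lemma₁ = solve-∀ ℚ-ring
    lemma₂ : ∀ c y z x → (ℕ→ℚ 2 + c) + (z + (y + x) + c * (1ℚ + y)) - (1ℚ + c) * y ≡ z + (x + (ℕ→ℚ 2 + ℕ→ℚ 2 * c))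
    lemma₂ = solve-∀ ℚ-ring

  partialSum-suc : ∀ c t x n {y} → partialSum (pathWeight c) t ≡ ℕ→ℚ x → c (suc t) ≡ ℕ→ℚ n →
    x ℕ.+ (2 ℕ.+ 2 ℕ.* n) ≡ y → partialSum (pathWeight c) (suc t) ≡ ℕ→ℚ y
  partialSum-suc c t x n X≡x c≡n refl = begin
    partialSum (pathWeight c) t + (ℕ→ℚ 2 + ℕ→ℚ 2 * c (suc t))  ≡⟨ cong₂ (λ u v → u + (ℕ→ℚ 2 + ℕ→ℚ 2 * v)) X≡x c≡n ⟩
    ℕ→ℚ x + (ℕ→ℚ 2 + ℕ→ℚ 2 * ℕ→ℚ n)                           ≡⟨ cong (λ v → ℕ→ℚ x + (ℕ→ℚ 2 + v)) (sym (ℕ→ℚ-* 2 n)) ⟩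
    ℕ→ℚ x + (ℕ→ℚ 2 + ℕ→ℚ (2 ℕ.* n))                           ≡⟨ cong (ℕ→ℚ x +_) (sym (ℕ→ℚ-+ 2 (2 ℕ.* n))) ⟩
    ℕ→ℚ x + ℕ→ℚ (2 ℕ.+ 2 ℕ.* n)                               ≡⟨ sym (ℕ→ℚ-+ x _) ⟩
    ℕ→ℚ (x ℕ.+ (2 ℕ.+ 2 ℕ.* n))                               ∎
    where open ≡-Reasoning

  -- The sum of squares for the pendant pattern of a near double broom
  base : ℕ → ℕ → ℚ
  base n d = ℕ→ℚ (4 ℕ.* n ℕ.* n ℕ.+ 9) - ℕ→ℚ (11 ℕ.* n ℕ.+ d)

  oddSquare⁻ oddSquare⁺ : ℕ → ℕ → ℚ
  oddSquare⁻ a i = ℕ→ℚ ((2 ℕ.* a ℕ.+ 2 ℕ.* i ∸ 1) ℕ.* (2 ℕ.* a ℕ.+ 2 ℕ.* i ∸ 1))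
  oddSquare⁺ a i = ℕ→ℚ ((2 ℕ.* a ℕ.+ 2 ℕ.* i ℕ.+ 1) ℕ.* (2 ℕ.* a ℕ.+ 2 ℕ.* i ℕ.+ 1))

  module BroomPartialSums (a b p q : ℕ) (c : ℕ → ℚ)
    (c-0 : c 0 ≡ 0ℚ) (c-1 : c 1 ≡ ℕ→ℚ a)
    (c-left : ∀ t → 2 ≤ t → t < 2 ℕ.+ p → c t ≡ 0ℚ) (c-K : c (2 ℕ.+ p) ≡ 1ℚ)
    (c-right : ∀ t → 2 ℕ.+ p < t → suc t < 4 ℕ.+ p ℕ.+ q → c t ≡ 0ℚ) (c-last : c (3 ℕ.+ p ℕ.+ q) ≡ ℕ→ℚ b) where

    private
      X : ℕ → ℚ
      X = partialSum (pathWeight c)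

      X-0 : X 0 ≡ ℕ→ℚ 1
      X-0 = trans (cong (λ v → 1ℚ + ℕ→ℚ 2 * v) c-0) (ℚₚ.+-identityʳ 1ℚ)

      X-left : ∀ s → s ≤ p → X (suc s) ≡ ℕ→ℚ (3 ℕ.+ 2 ℕ.* a ℕ.+ 2 ℕ.* s)
      X-left zero    _   = partialSum-suc c 0 1 a X-0 c-1 (lemma a)
        where
        lemma : ∀ a → 1 ℕ.+ (2 ℕ.+ 2 ℕ.* a) ≡ 3 ℕ.+ 2 ℕ.* a ℕ.+ 2 ℕ.* 0
        lemma = ℕ-Ring.solve-∀
      X-left (suc s) s<p = partialSum-suc c (suc s) (3 ℕ.+ 2 ℕ.* a ℕ.+ 2 ℕ.* s) 0 (X-left s (ℕₚ.<⇒≤ s<p))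
        (c-left (2 ℕ.+ s) (s≤s (s≤s z≤n)) (s≤s (s≤s s<p))) (lemma a s)
        where
        lemma : ∀ a s → 3 ℕ.+ 2 ℕ.* a ℕ.+ 2 ℕ.* s ℕ.+ (2 ℕ.+ 2 ℕ.* 0) ≡ 3 ℕ.+ 2 ℕ.* a ℕ.+ 2 ℕ.* suc s
        lemma = ℕ-Ring.solve-∀

      X-right : ∀ s → s ≤ q → X (2 ℕ.+ p ℕ.+ s) ≡ ℕ→ℚ (7 ℕ.+ 2 ℕ.* a ℕ.+ 2 ℕ.* p ℕ.+ 2 ℕ.* s)
      X-right zero    _   = trans (cong X (ℕₚ.+-identityʳ (2 ℕ.+ p)))
        (partialSum-suc c (suc p) (3 ℕ.+ 2 ℕ.* a ℕ.+ 2 ℕ.* p) 1 (X-left p ℕₚ.≤-refl) c-K (lemma a p))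
        where
        lemma : ∀ a p → 3 ℕ.+ 2 ℕ.* a ℕ.+ 2 ℕ.* p ℕ.+ (2 ℕ.+ 2 ℕ.* 1) ≡ 7 ℕ.+ 2 ℕ.* a ℕ.+ 2 ℕ.* p ℕ.+ 2 ℕ.* 0
        lemma = ℕ-Ring.solve-∀
      X-right (suc s) s<q = trans (cong X (ℕₚ.+-suc (2 ℕ.+ p) s))
        (partialSum-suc c (2 ℕ.+ p ℕ.+ s) (7 ℕ.+ 2 ℕ.* a ℕ.+ 2 ℕ.* p ℕ.+ 2 ℕ.* s) 0 (X-right s (ℕₚ.<⇒≤ s<q))
          (c-right _ (s≤s (ℕₚ.m≤m+n (2 ℕ.+ p) s)) (s≤s (s≤s (s≤s (s≤s (ℕₚ.+-monoʳ-< p s<q)))))) (lemma a p s))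
        where
        lemma : ∀ a p s → 7 ℕ.+ 2 ℕ.* a ℕ.+ 2 ℕ.* p ℕ.+ 2 ℕ.* s ℕ.+ (2 ℕ.+ 2 ℕ.* 0) ≡ 7 ℕ.+ 2 ℕ.* a ℕ.+ 2 ℕ.* p ℕ.+ 2 ℕ.* suc s
        lemma = ℕ-Ring.solve-∀

      X-last : X (3 ℕ.+ p ℕ.+ q) ≡ ℕ→ℚ (9 ℕ.+ 2 ℕ.* a ℕ.+ 2 ℕ.* p ℕ.+ 2 ℕ.* q ℕ.+ 2 ℕ.* b)
      X-last = partialSum-suc c (2 ℕ.+ p ℕ.+ q) (7 ℕ.+ 2 ℕ.* a ℕ.+ 2 ℕ.* p ℕ.+ 2 ℕ.* q) b (X-right q ℕₚ.≤-refl) c-last (lemma a p q b)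
        where
        lemma : ∀ a p q b → 7 ℕ.+ 2 ℕ.* a ℕ.+ 2 ℕ.* p ℕ.+ 2 ℕ.* q ℕ.+ (2 ℕ.+ 2 ℕ.* b) ≡ 9 ℕ.+ 2 ℕ.* a ℕ.+ 2 ℕ.* p ℕ.+ 2 ℕ.* q ℕ.+ 2 ℕ.* b
        lemma = ℕ-Ring.solve-∀

    L = suc a
    K = 2 ℕ.+ p
    D = 4 ℕ.+ p ℕ.+ q
    n = L ℕ.+ suc b ℕ.+ D

    private
      X² : ℕ → ℚ
      X² t = X t * X t

      left-sum : sumFrom 1 (suc p) X² ≡ sumRange 1 (K ∸ 1) (oddSquare⁻ L)
      left-sum = sumFrom-cong 1 (suc p) {X²} {oddSquare⁻ L} (λ s s≤p → ℕ→ℚ-square (2 ℕ.* L ℕ.+ 2 ℕ.* (1 ℕ.+ s) ∸ 1) (trans (X-left s (ℕₚ.≤-pred s≤p)) (cong ℕ→ℚ (cong (_∸ 1) (lemma a s)))))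
        where
        lemma : ∀ a s → suc (3 ℕ.+ 2 ℕ.* a ℕ.+ 2 ℕ.* s) ≡ 2 ℕ.* suc a ℕ.+ 2 ℕ.* suc s
        lemma = ℕ-Ring.solve-∀

      right-sum : sumFrom K (suc q) X² ≡ sumRange K (D ∸ 2) (oddSquare⁺ L)
      right-sum = trans (sumFrom-cong K (suc q) {X²} {oddSquare⁺ L} (λ s s≤q → ℕ→ℚ-square (2 ℕ.* L ℕ.+ 2 ℕ.* (K ℕ.+ s) ℕ.+ 1) (trans (X-right s (ℕₚ.≤-pred s≤q)) (cong ℕ→ℚ (lemma a p s)))))
                        (cong (λ m → sumFrom K m (oddSquare⁺ L)) (sym length))
        where
        lemma : ∀ a p s → 7 ℕ.+ 2 ℕ.* a ℕ.+ 2 ℕ.* p ℕ.+ 2 ℕ.* s ≡ 2 ℕ.* suc a ℕ.+ 2 ℕ.* (2 ℕ.+ p ℕ.+ s) ℕ.+ 1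
        lemma = ℕ-Ring.solve-∀
        length : suc (2 ℕ.+ p ℕ.+ q) ∸ K ≡ suc q
        length = trans (cong (_∸ p) (sym (ℕₚ.+-suc p q))) (ℕₚ.m+n∸m≡n p (suc q))

      e = 9 ℕ.+ 2 ℕ.* a ℕ.+ 2 ℕ.* p ℕ.+ 2 ℕ.* q ℕ.+ 2 ℕ.* b

      split : sumFrom 0 D X² ≡ ℕ→ℚ 1 + (sumFrom 1 (suc p) X² + (sumFrom K (suc q) X² + ℕ→ℚ (e ℕ.* e)))
      split = begin
        X² 0 + sumFrom 1 (3 ℕ.+ p ℕ.+ q) X²
          ≡⟨ cong (λ m → X² 0 + sumFrom 1 m X²) (lemma p q) ⟩
        X² 0 + sumFrom 1 (suc p ℕ.+ suc (suc q)) X²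
          ≡⟨ cong (X² 0 +_) (sumFrom-++ 1 (suc p) (suc (suc q)) X²) ⟩
        X² 0 + (sumFrom 1 (suc p) X² + sumFrom K (suc (suc q)) X²)
          ≡⟨ cong (λ s → X² 0 + (sumFrom 1 (suc p) X² + s)) (sumFrom-snoc K (suc q) X²) ⟩
        X² 0 + (sumFrom 1 (suc p) X² + (sumFrom K (suc q) X² + X² (K ℕ.+ suc q)))
          ≡⟨ cong₂ (λ u v → u + (sumFrom 1 (suc p) X² + (sumFrom K (suc q) X² + v))) (ℕ→ℚ-square 1 X-0)
                   (ℕ→ℚ-square e (trans (cong X (ℕₚ.+-suc K q)) X-last)) ⟩
        ℕ→ℚ 1 + (sumFrom 1 (suc p) X² + (sumFrom K (suc q) X² + ℕ→ℚ (e ℕ.* e))) ∎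
        where
        open ≡-Reasoning
        lemma : ∀ p q → 3 ℕ.+ p ℕ.+ q ≡ suc p ℕ.+ suc (suc q)
        lemma = ℕ-Ring.solve-∀

      constant-terms : ℕ→ℚ 1 + ℕ→ℚ (e ℕ.* e) + ℕ→ℚ (a ℕ.+ b ℕ.+ 1) ≡ base n D
      constant-terms = begin
        ℕ→ℚ 1 + ℕ→ℚ (e ℕ.* e) + ℕ→ℚ (a ℕ.+ b ℕ.+ 1)
          ≡⟨ cong (_+ ℕ→ℚ (a ℕ.+ b ℕ.+ 1)) (sym (ℕ→ℚ-+ 1 (e ℕ.* e))) ⟩
        ℕ→ℚ (1 ℕ.+ e ℕ.* e) + ℕ→ℚ (a ℕ.+ b ℕ.+ 1)
          ≡⟨ sym (ℕ→ℚ-+ (1 ℕ.+ e ℕ.* e) (a ℕ.+ b ℕ.+ 1)) ⟩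
        ℕ→ℚ (1 ℕ.+ e ℕ.* e ℕ.+ (a ℕ.+ b ℕ.+ 1))
          ≡⟨ ℕ→ℚ-sub (1 ℕ.+ e ℕ.* e ℕ.+ (a ℕ.+ b ℕ.+ 1)) (4 ℕ.* n ℕ.* n ℕ.+ 9) (11 ℕ.* n ℕ.+ D) (lemma a b p q) ⟩
        base n D ∎
        where
        open ≡-Reasoning
        lemma : ∀ a b p q →
          let e = 9 ℕ.+ 2 ℕ.* a ℕ.+ 2 ℕ.* p ℕ.+ 2 ℕ.* q ℕ.+ 2 ℕ.* b
              n = suc a ℕ.+ suc b ℕ.+ (4 ℕ.+ p ℕ.+ q)
          in 1 ℕ.+ e ℕ.* e ℕ.+ (a ℕ.+ b ℕ.+ 1) ℕ.+ (11 ℕ.* n ℕ.+ (4 ℕ.+ p ℕ.+ q)) ≡ 4 ℕ.* n ℕ.* n ℕ.+ 9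
        lemma = ℕ-Ring.solve-∀

    sum-partialSum² : sumFrom 0 D X² + ℕ→ℚ (a ℕ.+ b ℕ.+ 1)
      ≡ base n D + sumRange 1 (K ∸ 1) (oddSquare⁻ L) + sumRange K (D ∸ 2) (oddSquare⁺ L)
    sum-partialSum² = begin
      sumFrom 0 D X² + ℕ→ℚ (a ℕ.+ b ℕ.+ 1)
        ≡⟨ cong (_+ ℕ→ℚ (a ℕ.+ b ℕ.+ 1)) (trans split (cong₂ (λ u v → ℕ→ℚ 1 + (u + (v + ℕ→ℚ (e ℕ.* e)))) left-sum right-sum)) ⟩
      ℕ→ℚ 1 + (A + (B + ℕ→ℚ (e ℕ.* e))) + ℕ→ℚ (a ℕ.+ b ℕ.+ 1)
        ≡⟨ lemma (ℕ→ℚ 1) A B (ℕ→ℚ (e ℕ.* e)) (ℕ→ℚ (a ℕ.+ b ℕ.+ 1)) ⟩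
      ℕ→ℚ 1 + ℕ→ℚ (e ℕ.* e) + ℕ→ℚ (a ℕ.+ b ℕ.+ 1) + A + B
        ≡⟨ cong (λ z → z + A + B) constant-terms ⟩
      base n D + A + B ∎
      where
      open ≡-Reasoning
      A = sumRange 1 (K ∸ 1) (oddSquare⁻ L)
      B = sumRange K (D ∸ 2) (oddSquare⁺ L)
      lemma : ∀ o a b e c → o + (a + (b + e)) + c ≡ o + e + c + a + b
      lemma = solve-∀ ℚ-ring

  sum-partialSum²-closedForm : ∀ a b p q K D → K ≡ 2 ℕ.+ p → D ≡ 4 ℕ.+ p ℕ.+ q → (c : ℕ → ℚ) →
    c 0 ≡ 0ℚ → c 1 ≡ ℕ→ℚ a → (∀ t → 2 ≤ t → t < K → c t ≡ 0ℚ) → c K ≡ 1ℚ →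
    (∀ t → K < t → suc t < D → c t ≡ 0ℚ) → c (D ∸ 1) ≡ ℕ→ℚ b →
    let X = partialSum (pathWeight c)
    in sumFrom 0 D (λ t → X t * X t) + ℕ→ℚ (a ℕ.+ b ℕ.+ 1)
         ≡ base (suc a ℕ.+ suc b ℕ.+ D) D + sumRange 1 (K ∸ 1) (oddSquare⁻ (suc a)) + sumRange K (D ∸ 2) (oddSquare⁺ (suc a))
  sum-partialSum²-closedForm a b p q _ _ refl refl c = BroomPartialSums.sum-partialSum² a b p q c

  ∣suc-∣≡suc∣-∣ : ∀ m p → p ≤ m → ∣ suc m - p ∣ ≡ suc ∣ m - p ∣
  ∣suc-∣≡suc∣-∣ zero    zero    _         = refl
  ∣suc-∣≡suc∣-∣ (suc m) zero    _         = refl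
  ∣suc-∣≡suc∣-∣ (suc m) (suc p) (s≤s p≤m) = ∣suc-∣≡suc∣-∣ m p p≤m

  ∣-∣≡suc∣suc-∣ : ∀ m p → m < p → ∣ m - p ∣ ≡ suc ∣ suc m - p ∣
  ∣-∣≡suc∣suc-∣ zero    (suc p) _         = refl
  ∣-∣≡suc∣suc-∣ (suc m) (suc p) (s≤s m<p) = ∣-∣≡suc∣suc-∣ m p m<p

  ∣suc-∣≡1 : ∀ m → ∣ suc m - m ∣ ≡ 1
  ∣suc-∣≡1 m = trans (∣suc-∣≡suc∣-∣ m m ℕₚ.≤-refl) (cong suc (ℕₚ.∣n-n∣≡0 m))

  ∣-suc∣≡1 : ∀ m → ∣ m - suc m ∣ ≡ 1
  ∣-suc∣≡1 m = trans (∣-∣≡suc∣suc-∣ m (suc m) ℕₚ.≤-refl) (cong suc (ℕₚ.∣n-n∣≡0 m))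

  ∣-∣-start : ∀ p c → ℕ→ℚ ∣ 1 - p ∣ + c ≡ 1ℚ * (ℕ→ℚ ∣ 0 - p ∣ + 1ℚ + c) - ℕ→ℚ 2 + ℕ→ℚ 2 * 𝟙 ⌊ 0 ≟ p ⌋
  ∣-∣-start zero    c = lemma c
    where
    lemma : ∀ c → ℕ→ℚ 1 + c ≡ 1ℚ * (ℕ→ℚ 0 + 1ℚ + c) - ℕ→ℚ 2 + ℕ→ℚ 2 * 𝟙 true
    lemma = solve-∀ ℚ-ring
  ∣-∣-start (suc p) c rewrite ℕ→ℚ-suc p = lemma (ℕ→ℚ p) c
    where
    lemma : ∀ x c → x + c ≡ 1ℚ * (1ℚ + x + 1ℚ + c) - ℕ→ℚ 2 + ℕ→ℚ 2 * 𝟙 false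
    lemma = solve-∀ ℚ-ring

  ∣-∣-end : ∀ m p c → p ≤ suc m → ℕ→ℚ ∣ m - p ∣ + c ≡ 1ℚ * (ℕ→ℚ ∣ suc m - p ∣ + 1ℚ + c) - ℕ→ℚ 2 + ℕ→ℚ 2 * 𝟙 ⌊ suc m ≟ p ⌋
  ∣-∣-end m p c p≤1+m with ℕₚ.m≤n⇒m<n∨m≡n p≤1+m
  ... | inj₂ refl rewrite ∣-suc∣≡1 m | ℕₚ.∣n-n∣≡0 (suc m) | ≟-refl (suc m) = lemma c
    where
    lemma : ∀ c → ℕ→ℚ 1 + c ≡ 1ℚ * (ℕ→ℚ 0 + 1ℚ + c) - ℕ→ℚ 2 + ℕ→ℚ 2 * 𝟙 true
    lemma = solve-∀ ℚ-ring
  ... | inj₁ p<1+m rewrite ∣suc-∣≡suc∣-∣ m p (ℕₚ.≤-pred p<1+m) | ℕ→ℚ-suc ∣ m - p ∣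
                         | ≢⇒≟-false (λ 1+m≡p → ℕₚ.<-irrefl (sym 1+m≡p) p<1+m) = lemma (ℕ→ℚ ∣ m - p ∣) c
    where
    lemma : ∀ x c → x + c ≡ 1ℚ * (1ℚ + x + 1ℚ + c) - ℕ→ℚ 2 + ℕ→ℚ 2 * 𝟙 false
    lemma = solve-∀ ℚ-ring

  ∣-∣-interior : ∀ t p c → (ℕ→ℚ ∣ suc (suc t) - p ∣ + c) + (ℕ→ℚ ∣ t - p ∣ + c)
                           ≡ ℕ→ℚ 2 * (ℕ→ℚ ∣ suc t - p ∣ + 1ℚ + c) - ℕ→ℚ 2 + ℕ→ℚ 2 * 𝟙 ⌊ suc t ≟ p ⌋
  ∣-∣-interior t p c with ℕₚ.<-cmp p (suc t)
  ... | tri< p<1+t _ _ rewrite ∣suc-∣≡suc∣-∣ (suc t) p (ℕₚ.<⇒≤ p<1+t) | ∣suc-∣≡suc∣-∣ t p (ℕₚ.≤-pred p<1+t)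
                             | ℕ→ℚ-suc (suc ∣ t - p ∣) | ℕ→ℚ-suc ∣ t - p ∣
                             | ≢⇒≟-false (λ 1+t≡p → ℕₚ.<-irrefl (sym 1+t≡p) p<1+t) = lemma (ℕ→ℚ ∣ t - p ∣) c
    where
    lemma : ∀ x c → (1ℚ + (1ℚ + x) + c) + (x + c) ≡ ℕ→ℚ 2 * (1ℚ + x + 1ℚ + c) - ℕ→ℚ 2 + ℕ→ℚ 2 * 𝟙 false
    lemma = solve-∀ ℚ-ring
  ... | tri≈ _ refl _ rewrite ∣suc-∣≡1 (suc t) | ∣-suc∣≡1 t | ℕₚ.∣n-n∣≡0 (suc t) | ≟-refl (suc t) = lemma c
    where
    lemma : ∀ c → (ℕ→ℚ 1 + c) + (ℕ→ℚ 1 + c) ≡ ℕ→ℚ 2 * (ℕ→ℚ 0 + 1ℚ + c) - ℕ→ℚ 2 + ℕ→ℚ 2 * 𝟙 true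
    lemma = solve-∀ ℚ-ring
  ... | tri> _ _ 1+t<p rewrite ∣-∣≡suc∣suc-∣ t p (ℕₚ.<-trans (ℕₚ.n<1+n t) 1+t<p) | ∣-∣≡suc∣suc-∣ (suc t) p 1+t<p
                             | ℕ→ℚ-suc (suc ∣ suc (suc t) - p ∣) | ℕ→ℚ-suc ∣ suc (suc t) - p ∣
                             | ≢⇒≟-false (λ 1+t≡p → ℕₚ.<-irrefl 1+t≡p 1+t<p) = lemma (ℕ→ℚ ∣ suc (suc t) - p ∣) c
    where
    lemma : ∀ x c → (x + c) + (1ℚ + (1ℚ + x) + c) ≡ ℕ→ℚ 2 * (1ℚ + x + 1ℚ + c) - ℕ→ℚ 2 + ℕ→ℚ 2 * 𝟙 false
    lemma = solve-∀ ℚ-ring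

  clamp : ∀ n → ℕ → Fin (suc n)
  clamp n       zero    = zero
  clamp zero    (suc i) = zero
  clamp (suc n) (suc i) = suc (clamp n i)

  clamp-toℕ : ∀ n (j : Fin (suc n)) → clamp n (toℕ j) ≡ j
  clamp-toℕ n       zero    = refl
  clamp-toℕ (suc n) (suc j) = cong suc (clamp-toℕ n j)

  toℕ-clamp : ∀ n i → i ≤ n → toℕ (clamp n i) ≡ i
  toℕ-clamp n       zero    _         = refl
  toℕ-clamp (suc n) (suc i) (s≤s i≤n) = cong suc (toℕ-clamp n i i≤n)

  clamp-fromℕ : ∀ n → clamp n n ≡ fromℕ n
  clamp-fromℕ zero    = refl
  clamp-fromℕ (suc n) = cong suc (clamp-fromℕ n)

  -- ℓ = 1 + l, r = 1 + r', d = 4 + d' and k = 2 + k' with k' ≤ d': the hypotheses of lemma4p4 by construction.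
  module Broom (l r' d' k' : ℕ) (k'≤d' : k' ≤ d') where

    d = 4 ℕ.+ d'
    k = 2 ℕ.+ k'
    n = suc l ℕ.+ suc r' ℕ.+ d

    open NDB (suc l) (suc r') d k public

    k≤d : k ≤ d
    k≤d = s≤s (s≤s (ℕₚ.≤-trans k'≤d' (ℕₚ.m≤n+m d' 2)))

    k<d∸1 : k < d ∸ 1
    k<d∸1 = s≤s (s≤s (s≤s k'≤d'))

    _≟V_ : DecidableEquality V
    pv i ≟V pv j = map′ (cong pv) (λ { refl → refl }) (i Finₚ.≟ j)
    lf i ≟V lf j = map′ (cong lf) (λ { refl → refl }) (i Finₚ.≟ j)
    rt i ≟V rt j = map′ (cong rt) (λ { refl → refl }) (i Finₚ.≟ j)
    zz   ≟V zz   = yes refl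
    pv _ ≟V lf _ = no λ ()
    pv _ ≟V rt _ = no λ ()
    pv _ ≟V zz   = no λ ()
    lf _ ≟V pv _ = no λ ()
    lf _ ≟V rt _ = no λ ()
    lf _ ≟V zz   = no λ ()
    rt _ ≟V pv _ = no λ ()
    rt _ ≟V lf _ = no λ ()
    rt _ ≟V zz   = no λ ()
    zz   ≟V pv _ = no λ ()
    zz   ≟V lf _ = no λ ()
    zz   ≟V rt _ = no λ ()

    -- does rather than ⌊_⌋, so that δ (pv i) (pv j) reduces to the decision of i ≟ j.
    δ : V → V → ℚ
    δ u w = 𝟙 (does (u ≟V w))

    δ-refl : ∀ u → δ u u ≡ 1ℚ
    δ-refl u with u ≟V u
    ... | yes _   = refl
    ... | no u≢u  = ⊥-elim (u≢u refl)

    δ-≢ : ∀ {u w} → u ≢ w → δ u w ≡ 0ℚ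
    δ-≢ {u} {w} u≢w with u ≟V w
    ... | yes u≡w = ⊥-elim (u≢w u≡w)
    ... | no _    = refl

    δ-comm : ∀ u w → δ u w ≡ δ w u
    δ-comm u w with u ≟V w
    ... | yes refl = sym (δ-refl u)
    ... | no u≢w   = sym (δ-≢ (u≢w ∘ sym))

    δ-subst : ∀ u w (f : V → ℚ) → δ u w * f w ≡ δ u w * f u
    δ-subst u w f with u ≟V w
    ... | yes refl = refl
    ... | no _     = trans (𝟙-false (f w)) (sym (𝟙-false (f u)))

    sumV-cong : ∀ {f g : V → ℚ} → (∀ w → f w ≡ g w) → sumV f ≡ sumV g
    sumV-cong f≗g = +-cong₄ (sumFin-cong (suc d) (f≗g ∘ pv)) (sumFin-cong l (f≗g ∘ lf)) (sumFin-cong r' (f≗g ∘ rt)) (f≗g zz)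

    sumV-+ : ∀ (f g : V → ℚ) → sumV (λ w → f w + g w) ≡ sumV f + sumV g
    sumV-+ f g = trans
      (+-cong₄ (sumFin-+ (suc d) (f ∘ pv) (g ∘ pv)) (sumFin-+ l (f ∘ lf) (g ∘ lf)) (sumFin-+ r' (f ∘ rt) (g ∘ rt)) refl)
      (lemma (sumFin (suc d) (f ∘ pv)) (sumFin (suc d) (g ∘ pv)) (sumFin l (f ∘ lf)) (sumFin l (g ∘ lf))
             (sumFin r' (f ∘ rt)) (sumFin r' (g ∘ rt)) (f zz) (g zz))
      where
      lemma : ∀ a b c d e f g h → (a + b) + (c + d) + (e + f) + (g + h) ≡ (a + c + e + g) + (b + d + f + h)
      lemma = solve-∀ ℚ-ring

    sumV-*ˡ : ∀ c (f : V → ℚ) → sumV (λ w → c * f w) ≡ c * sumV f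
    sumV-*ˡ c f = trans
      (+-cong₄ (sumFin-*ˡ (suc d) c (f ∘ pv)) (sumFin-*ˡ l c (f ∘ lf)) (sumFin-*ˡ r' c (f ∘ rt)) refl)
      (lemma c _ _ _ (f zz))
      where
      lemma : ∀ c a b e g → c * a + c * b + c * e + c * g ≡ c * (a + b + e + g)
      lemma = solve-∀ ℚ-ring

    sumV-sumFin : ∀ m (B : V → Fin m → ℚ) → sumV (λ w → sumFin m (B w)) ≡ sumFin m (λ j → sumV (λ w → B w j))
    sumV-sumFin m B = begin
      sumFin (suc d) (λ i → sumFin m (B (pv i))) + sumFin l (λ i → sumFin m (B (lf i)))
        + sumFin r' (λ i → sumFin m (B (rt i))) + sumFin m (B zz)
        ≡⟨ +-cong₄ (sumFin-comm (suc d) m (B ∘ pv)) (sumFin-comm l m (B ∘ lf)) (sumFin-comm r' m (B ∘ rt)) refl ⟩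
      sumFin m (λ j → sumFin (suc d) (λ i → B (pv i) j)) + sumFin m (λ j → sumFin l (λ i → B (lf i) j))
        + sumFin m (λ j → sumFin r' (λ i → B (rt i) j)) + sumFin m (B zz)
        ≡⟨ sym (trans (sumFin-+ m _ (B zz)) (cong (_+ sumFin m (B zz)) (trans (sumFin-+ m _ _) (cong (_+ _) (sumFin-+ m _ _))))) ⟩
      sumFin m (λ j → sumV (λ w → B w j)) ∎
      where open ≡-Reasoning

    sumV-comm : ∀ (A : V → V → ℚ) → sumV (λ w → sumV (A w)) ≡ sumV (λ x → sumV (λ w → A w x))
    sumV-comm A = begin
      sumV (λ w → sumV (A w))
        ≡⟨ trans (sumV-+ (λ w → P w + Lf w + R w) (λ w → A w zz))
                 (cong (_+ sumV (λ w → A w zz)) (trans (sumV-+ (λ w → P w + Lf w) R) (cong (_+ sumV R) (sumV-+ P Lf)))) ⟩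
      sumV (λ w → sumFin (suc d) (A w ∘ pv)) + sumV (λ w → sumFin l (A w ∘ lf))
        + sumV (λ w → sumFin r' (A w ∘ rt)) + sumV (λ w → A w zz)
        ≡⟨ +-cong₄ (sumV-sumFin (suc d) (λ w → A w ∘ pv)) (sumV-sumFin l (λ w → A w ∘ lf)) (sumV-sumFin r' (λ w → A w ∘ rt)) refl ⟩
      sumV (λ x → sumV (λ w → A w x)) ∎
      where
      open ≡-Reasoning
      P Lf R : V → ℚ
      P w = sumFin (suc d) (A w ∘ pv)
      Lf w = sumFin l (A w ∘ lf)
      R w = sumFin r' (A w ∘ rt)

    sumV-select : ∀ x (f : V → ℚ) → sumV (λ w → δ w x * f w) ≡ f x
    sumV-select (pv j) f = trans
      (+-cong₄ (sumFin-select (suc d) j (f ∘ pv)) (sumFin-𝟙-false l (f ∘ lf)) (sumFin-𝟙-false r' (f ∘ rt)) (𝟙-false (f zz)))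
      (lemma (f (pv j)))
      where
      lemma : ∀ a → a + 0ℚ + 0ℚ + 0ℚ ≡ a
      lemma = solve-∀ ℚ-ring
    sumV-select (lf j) f = trans
      (+-cong₄ (sumFin-𝟙-false (suc d) (f ∘ pv)) (sumFin-select l j (f ∘ lf)) (sumFin-𝟙-false r' (f ∘ rt)) (𝟙-false (f zz)))
      (lemma (f (lf j)))
      where
      lemma : ∀ a → 0ℚ + a + 0ℚ + 0ℚ ≡ a
      lemma = solve-∀ ℚ-ring
    sumV-select (rt j) f = trans
      (+-cong₄ (sumFin-𝟙-false (suc d) (f ∘ pv)) (sumFin-𝟙-false l (f ∘ lf)) (sumFin-select r' j (f ∘ rt)) (𝟙-false (f zz)))
      (lemma (f (rt j)))
      where
      lemma : ∀ a → 0ℚ + 0ℚ + a + 0ℚ ≡ a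
      lemma = solve-∀ ℚ-ring
    sumV-select zz     f = trans
      (+-cong₄ (sumFin-𝟙-false (suc d) (f ∘ pv)) (sumFin-𝟙-false l (f ∘ lf)) (sumFin-𝟙-false r' (f ∘ rt)) (𝟙-true (f zz)))
      (lemma (f zz))
      where
      lemma : ∀ a → 0ℚ + 0ℚ + 0ℚ + a ≡ a
      lemma = solve-∀ ℚ-ring

    sumNbr-cong : ∀ u {f g : V → ℚ} → (∀ w → f w ≡ g w) → sumNbr u f ≡ sumNbr u g
    sumNbr-cong u f≗g = sumV-cong (λ w → cong (ind (adj u w) *_) (f≗g w))

    sumNbr-+ : ∀ u (f g : V → ℚ) → sumNbr u (λ w → f w + g w) ≡ sumNbr u f + sumNbr u g
    sumNbr-+ u f g = trans (sumV-cong (λ w → ℚₚ.*-distribˡ-+ (ind (adj u w)) (f w) (g w)))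
                           (sumV-+ (λ w → ind (adj u w) * f w) (λ w → ind (adj u w) * g w))

    sumNbr-*ˡ : ∀ u c (f : V → ℚ) → sumNbr u (λ w → c * f w) ≡ c * sumNbr u f
    sumNbr-*ˡ u c f = trans (sumV-cong (λ w → lemma (ind (adj u w)) c (f w))) (sumV-*ˡ c (λ w → ind (adj u w) * f w))
      where
      lemma : ∀ a c x → a * (c * x) ≡ c * (a * x)
      lemma = solve-∀ ℚ-ring

    sumNbr-const : ∀ u c → sumNbr u (λ _ → c) ≡ deg u * c
    sumNbr-const u c = trans (sumV-cong (λ w → lemma (ind (adj u w)) c)) (trans (sumV-*ˡ c (λ w → ind (adj u w) * ℕ→ℚ 1)) (ℚₚ.*-comm c (deg u)))
      where
      lemma : ∀ a c → a * c ≡ c * (a * ℕ→ℚ 1)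
      lemma = solve-∀ ℚ-ring

    sumNbr-δ : ∀ u x c → sumNbr u (λ w → δ w x * c) ≡ ind (adj u x) * c
    sumNbr-δ u x c = trans (sumV-cong (λ w → lemma (ind (adj u w)) (δ w x) c)) (sumV-select x (λ w → ind (adj u w) * c))
      where
      lemma : ∀ a e c → a * (e * c) ≡ e * (a * c)
      lemma = solve-∀ ℚ-ring

    sumNbr-comm : ∀ u (B : V → V → ℚ) → sumNbr u (λ w → sumV (B w)) ≡ sumV (λ x → sumNbr u (λ w → B w x))
    sumNbr-comm u B = trans (sumV-cong (λ w → sym (sumV-*ˡ (ind (adj u w)) (B w)))) (sumV-comm (λ w x → ind (adj u w) * B w x))

    onPath : (V → ℚ) → ℕ → ℚ
    onPath f i = f (pv (clamp d i))

    sumFin-pv : ∀ (F : ℕ → ℚ) (f : V → ℚ) → sumFin (suc d) (λ j → F (toℕ j) * f (pv j)) ≡ sumFrom 0 (suc d) (λ m → F m * onPath f m)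
    sumFin-pv F f = trans (sumFin-cong (suc d) (λ j → cong (λ j′ → F (toℕ j) * f (pv j′)) (sym (clamp-toℕ d j))))
                          (sumFin≡sumFrom (suc d) (λ m → F m * onPath f m))

    above below pathSum : ℕ → (ℕ → ℚ) → ℚ
    above i g   = sumFrom 0 (suc d) (λ m → 𝟙 ⌊ m ≟ suc i ⌋ * g m)
    below i g   = sumFrom 0 (suc d) (λ m → 𝟙 ⌊ i ≟ suc m ⌋ * g m)
    pathSum i g = above i g + below i g

    pathDegree : ℕ → ℚ
    pathDegree i = pathSum i (λ _ → ℕ→ℚ 1)

    above-< : ∀ i g → suc i ≤ d → above i g ≡ g (suc i)
    above-< i g i<d = sumFrom-select 0 (suc d) (suc i) g z≤n (s≤s i<d)

    above-d : ∀ g → above d g ≡ 0ℚ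
    above-d g = sumFrom-select-∉ 0 (suc d) (suc d) g (λ m m≤d m≡1+d → ℕₚ.<-irrefl m≡1+d m≤d)

    below-0 : ∀ g → below 0 g ≡ 0ℚ
    below-0 g = trans (sumFrom-cong 0 (suc d) (λ m _ → 𝟙-false (g m))) (sumFrom-zero 0 (suc d))

    below-suc : ∀ i g → i ≤ d → below (suc i) g ≡ g i
    below-suc i g i≤d = trans
      (sumFrom-cong 0 (suc d) (λ m _ → cong (λ b → 𝟙 b * g m) (trans (≟-suc i m) (≟-comm i m))))
      (sumFrom-select 0 (suc d) i g z≤n (s≤s i≤d))

    pathSum-0 : ∀ g → pathSum 0 g ≡ g 1
    pathSum-0 g = trans (cong₂ _+_ (above-< 0 g (s≤s z≤n)) (below-0 g)) (ℚₚ.+-identityʳ (g 1))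

    pathSum-interior : ∀ t g → suc t < d → pathSum (suc t) g ≡ g (suc (suc t)) + g t
    pathSum-interior t g 1+t<d = cong₂ _+_ (above-< (suc t) g 1+t<d) (below-suc t g (ℕₚ.≤-trans (ℕₚ.n≤1+n t) (ℕₚ.<⇒≤ 1+t<d)))

    pathSum-d : ∀ g → pathSum d g ≡ g (d ∸ 1)
    pathSum-d g = trans (cong₂ _+_ (above-d g) (below-suc (d ∸ 1) g (ℕₚ.n≤1+n _))) (ℚₚ.+-identityˡ (g (d ∸ 1)))

    pathSum-reversed : ∀ t g → suc t < d → pathSum (d ∸ suc t) g ≡ g (d ∸ suc (suc t)) + g (d ∸ t)
    pathSum-reversed t g 1+t<d = begin
      pathSum (d ∸ suc t) g
        ≡⟨ cong (λ m → pathSum m g) i≡1+i′ ⟩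
      pathSum (suc i′) g
        ≡⟨ pathSum-interior i′ g (subst (_< d) i≡1+i′ (ℕₚ.∸-monoʳ-< (s≤s z≤n) (ℕₚ.<⇒≤ 1+t<d))) ⟩
      g (suc (suc i′)) + g i′
        ≡⟨ ℚₚ.+-comm (g (suc (suc i′))) (g i′) ⟩
      g i′ + g (suc (suc i′))
        ≡⟨ cong (λ m → g i′ + g m) (sym (trans (ℕₚ.+-∸-assoc 1 (ℕₚ.<⇒≤ 1+t<d)) (cong suc i≡1+i′))) ⟩
      g i′ + g (d ∸ t) ∎
      where
      open ≡-Reasoning
      i′ = d ∸ suc (suc t)
      i≡1+i′ : d ∸ suc t ≡ suc i′
      i≡1+i′ = ℕₚ.+-∸-assoc 1 1+t<d

    pathDegree-0 : pathDegree 0 ≡ 1ℚ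
    pathDegree-0 = pathSum-0 (λ _ → ℕ→ℚ 1)

    pathDegree-interior : ∀ i → 0 < i → i < d → pathDegree i ≡ ℕ→ℚ 2
    pathDegree-interior (suc t) _ 1+t<d = trans (pathSum-interior t (λ _ → ℕ→ℚ 1) 1+t<d) (sym (ℕ→ℚ-+ 1 1))

    pathDegree-d : pathDegree d ≡ 1ℚ
    pathDegree-d = pathSum-d (λ _ → ℕ→ℚ 1)

    pathSum-cong : ∀ i {g g′ : ℕ → ℚ} → (∀ m → m ≤ d → g m ≡ g′ m) → pathSum i g ≡ pathSum i g′
    pathSum-cong i g≗g′ = cong₂ _+_
      (sumFrom-cong 0 (suc d) (λ m m<1+d → cong (𝟙 ⌊ m ≟ suc i ⌋ *_) (g≗g′ m (ℕₚ.≤-pred m<1+d))))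
      (sumFrom-cong 0 (suc d) (λ m m<1+d → cong (𝟙 ⌊ i ≟ suc m ⌋ *_) (g≗g′ m (ℕₚ.≤-pred m<1+d))))

    pathSum-distance : ∀ i p c → i ≤ d → p ≤ d →
      pathSum i (λ m → ℕ→ℚ ∣ m - p ∣ + c) ≡ pathDegree i * (ℕ→ℚ ∣ i - p ∣ + 1ℚ + c) - ℕ→ℚ 2 + ℕ→ℚ 2 * 𝟙 ⌊ i ≟ p ⌋
    pathSum-distance zero p c _ _ = trans (pathSum-0 (λ m → ℕ→ℚ ∣ m - p ∣ + c))
      (trans (∣-∣-start p c) (cong (λ P → P * (ℕ→ℚ ∣ 0 - p ∣ + 1ℚ + c) - ℕ→ℚ 2 + ℕ→ℚ 2 * 𝟙 ⌊ 0 ≟ p ⌋) (sym pathDegree-0)))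
    pathSum-distance (suc t) p c 1+t≤d p≤d with ℕₚ.m≤n⇒m<n∨m≡n 1+t≤d
    ... | inj₁ 1+t<d = trans (pathSum-interior t (λ m → ℕ→ℚ ∣ m - p ∣ + c) 1+t<d)
      (trans (∣-∣-interior t p c) (cong (λ P → P * (ℕ→ℚ ∣ suc t - p ∣ + 1ℚ + c) - ℕ→ℚ 2 + ℕ→ℚ 2 * 𝟙 ⌊ suc t ≟ p ⌋)
                                        (sym (pathDegree-interior (suc t) (s≤s z≤n) 1+t<d))))
    ... | inj₂ refl  = trans (pathSum-d (λ m → ℕ→ℚ ∣ m - p ∣ + c))
      (trans (∣-∣-end t p c p≤d) (cong (λ P → P * (ℕ→ℚ ∣ d - p ∣ + 1ℚ + c) - ℕ→ℚ 2 + ℕ→ℚ 2 * 𝟙 ⌊ d ≟ p ⌋) (sym pathDegree-d)))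

    pendants : ℕ → ℚ
    pendants i = 𝟙 ⌊ i ≟ 1 ⌋ * ℕ→ℚ l + 𝟙 ⌊ i ≟ d ∸ 1 ⌋ * ℕ→ℚ r' + 𝟙 ⌊ i ≟ k ⌋

    private
      pendants-eval : ∀ i {a b c} → ⌊ i ≟ 1 ⌋ ≡ a → ⌊ i ≟ d ∸ 1 ⌋ ≡ b → ⌊ i ≟ k ⌋ ≡ c →
        pendants i ≡ 𝟙 a * ℕ→ℚ l + 𝟙 b * ℕ→ℚ r' + 𝟙 c
      pendants-eval i refl refl refl = refl

    pendants-none : ∀ i → i ≢ 1 → i ≢ d ∸ 1 → i ≢ k → pendants i ≡ 0ℚ
    pendants-none i i≢1 i≢d∸1 i≢k = trans (pendants-eval i (≢⇒≟-false i≢1) (≢⇒≟-false i≢d∸1) (≢⇒≟-false i≢k)) (lemma (ℕ→ℚ l) (ℕ→ℚ r'))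
      where
      lemma : ∀ x y → 𝟙 false * x + 𝟙 false * y + 𝟙 false ≡ 0ℚ
      lemma = solve-∀ ℚ-ring

    pendants-1 : pendants 1 ≡ ℕ→ℚ l
    pendants-1 = lemma (ℕ→ℚ l) (ℕ→ℚ r')
      where
      lemma : ∀ x y → 𝟙 true * x + 𝟙 false * y + 𝟙 false ≡ x
      lemma = solve-∀ ℚ-ring

    pendants-d∸1 : pendants (d ∸ 1) ≡ ℕ→ℚ r'
    pendants-d∸1 = trans (pendants-eval (d ∸ 1) refl (≟-refl (d ∸ 1)) (≢⇒≟-false (λ d∸1≡k → ℕₚ.<-irrefl (sym d∸1≡k) k<d∸1)))
                         (lemma (ℕ→ℚ l) (ℕ→ℚ r'))
      where
      lemma : ∀ x y → 𝟙 false * x + 𝟙 true * y + 𝟙 false ≡ y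
      lemma = solve-∀ ℚ-ring

    pendants-k : pendants k ≡ 1ℚ
    pendants-k = trans (pendants-eval k refl (≢⇒≟-false (λ k≡d∸1 → ℕₚ.<-irrefl k≡d∸1 k<d∸1)) (≟-refl k))
                       (lemma (ℕ→ℚ l) (ℕ→ℚ r'))
      where
      lemma : ∀ x y → 𝟙 false * x + 𝟙 false * y + 𝟙 true ≡ 1ℚ
      lemma = solve-∀ ℚ-ring

    pendants-0 : pendants 0 ≡ 0ℚ
    pendants-0 = pendants-none 0 (λ ()) (λ ()) (λ ())

    pendants-d : pendants d ≡ 0ℚ
    pendants-d = pendants-none d (λ ()) (λ d≡d∸1 → ℕₚ.<-irrefl (sym d≡d∸1) ℕₚ.≤-refl)
                                 (λ d≡k → ℕₚ.<-irrefl (sym d≡k) (ℕₚ.<-trans k<d∸1 ℕₚ.≤-refl))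

    pendants-left : ∀ i → 2 ≤ i → i < k → pendants i ≡ 0ℚ
    pendants-left i 2≤i i<k = pendants-none i (λ i≡1 → ℕₚ.<-irrefl (sym i≡1) 2≤i)
                                              (λ i≡d∸1 → ℕₚ.<-irrefl i≡d∸1 (ℕₚ.<-trans i<k k<d∸1))
                                              (λ i≡k → ℕₚ.<-irrefl i≡k i<k)

    pendants-right : ∀ i → k < i → suc i < d → pendants i ≡ 0ℚ
    pendants-right i k<i 1+i<d = pendants-none i (λ i≡1 → ℕₚ.<-irrefl (sym i≡1) (ℕₚ.<-trans (s≤s (s≤s z≤n)) k<i))
                                                 (λ i≡d∸1 → ℕₚ.<-irrefl i≡d∸1 (ℕₚ.≤-pred 1+i<d))
                                                 (λ i≡k → ℕₚ.<-irrefl (sym i≡k) k<i)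

    pendants-reversed-left : ∀ t → 2 ≤ t → t < d ∸ k → pendants (d ∸ t) ≡ 0ℚ
    pendants-reversed-left t 2≤t t<d∸k = pendants-right (d ∸ t) k<d∸t (s≤s (s≤s (ℕₚ.∸-monoʳ-≤ d 2≤t)))
      where
      k<d∸t : k < d ∸ t
      k<d∸t = ℕₚ.m+n≤o⇒m≤o∸n (suc k) (subst (_≤ d) (cong suc (ℕₚ.+-comm t k)) (ℕₚ.m≤o∸n⇒m+n≤o (suc t) k≤d t<d∸k))

    pendants-reversed-right : ∀ t → d ∸ k < t → suc t < d → pendants (d ∸ t) ≡ 0ℚ
    pendants-reversed-right t d∸k<t 1+t<d = pendants-left (d ∸ t) (ℕₚ.m+n≤o⇒m≤o∸n 2 1+t<d) (ℕₚ.m<n+o⇒m∸n<o d t d<t+k)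
      where
      d<t+k : d < t ℕ.+ k
      d<t+k = subst (_< t ℕ.+ k) (ℕₚ.m∸n+n≡m k≤d) (ℕₚ.+-monoˡ-< k d∸k<t)

    sumFrom-pendants : ∀ g → sumFrom 0 (suc d) (λ m → pendants m * g m) ≡ ℕ→ℚ l * g 1 + ℕ→ℚ r' * g (d ∸ 1) + g k
    sumFrom-pendants g = begin
      sumFrom 0 (suc d) (λ m → pendants m * g m)
        ≡⟨ sumFrom-cong 0 (suc d) (λ m _ → lemma (𝟙 ⌊ m ≟ 1 ⌋) (𝟙 ⌊ m ≟ d ∸ 1 ⌋) (𝟙 ⌊ m ≟ k ⌋) (ℕ→ℚ l) (ℕ→ℚ r') (g m)) ⟩
      sumFrom 0 (suc d) (λ m → A m + B m + C m)
        ≡⟨ trans (sumFrom-+ 0 (suc d) (λ m → A m + B m) C) (cong (_+ sumFrom 0 (suc d) C) (sumFrom-+ 0 (suc d) A B)) ⟩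
      sumFrom 0 (suc d) A + sumFrom 0 (suc d) B + sumFrom 0 (suc d) C
        ≡⟨ cong₂ _+_ (cong₂ _+_ (sumFrom-select 0 (suc d) 1 (λ m → ℕ→ℚ l * g m) z≤n (s≤s (s≤s z≤n)))
                                (sumFrom-select 0 (suc d) (d ∸ 1) (λ m → ℕ→ℚ r' * g m) z≤n (s≤s (ℕₚ.n≤1+n _))))
                     (sumFrom-select 0 (suc d) k g z≤n (s≤s k≤d)) ⟩
      ℕ→ℚ l * g 1 + ℕ→ℚ r' * g (d ∸ 1) + g k ∎
      where
      open ≡-Reasoning
      A B C : ℕ → ℚ
      A m = 𝟙 ⌊ m ≟ 1 ⌋ * (ℕ→ℚ l * g m)
      B m = 𝟙 ⌊ m ≟ d ∸ 1 ⌋ * (ℕ→ℚ r' * g m)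
      C m = 𝟙 ⌊ m ≟ k ⌋ * g m
      lemma : ∀ a b c x y z → (a * x + b * y + c) * z ≡ a * (x * z) + b * (y * z) + c * z
      lemma = solve-∀ ℚ-ring

    position : V → ℕ
    position (pv j) = toℕ j
    position (lf _) = 1
    position (rt _) = d ∸ 1
    position zz     = k

    position≤d : ∀ u → position u ≤ d
    position≤d (pv j) = ℕₚ.≤-pred (Finₚ.toℕ<n j)
    position≤d (lf _) = s≤s z≤n
    position≤d (rt _) = ℕₚ.n≤1+n _
    position≤d zz     = k≤d

    pv-clamp-≢ : ∀ i j → i ≤ d → i ≢ toℕ j → pv (clamp d i) ≢ pv j
    pv-clamp-≢ i j i≤d i≢j pv≡pv = i≢j (trans (sym (toℕ-clamp d i i≤d)) (cong position pv≡pv))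

    data Pendant : V → Set where
      lf : ∀ j → Pendant (lf j)
      rt : ∀ j → Pendant (rt j)
      zz : Pendant zz

    sumNbr-pv : ∀ j f → let i = toℕ j in
      sumNbr (pv j) f ≡ pathSum i (onPath f) + 𝟙 ⌊ i ≟ 1 ⌋ * sumFin l (f ∘ lf) + 𝟙 ⌊ i ≟ d ∸ 1 ⌋ * sumFin r' (f ∘ rt) + 𝟙 ⌊ i ≟ k ⌋ * f zz
    sumNbr-pv j f = +-cong₄ path-block (sumFin-*ˡ l (𝟙 ⌊ i ≟ 1 ⌋) (f ∘ lf)) (sumFin-*ˡ r' (𝟙 ⌊ i ≟ d ∸ 1 ⌋) (f ∘ rt)) refl
      where
      i = toℕ j
      𝟙-∨ : ∀ m → 𝟙 (⌊ m ≟ suc i ⌋ ∨ ⌊ i ≟ suc m ⌋) * f (pv (clamp d m)) ≡ 𝟙 ⌊ m ≟ suc i ⌋ * onPath f m + 𝟙 ⌊ i ≟ suc m ⌋ * onPath f m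
      𝟙-∨ m with m ≟ suc i | i ≟ suc m
      ... | yes refl | yes i≡2+i = ⊥-elim (ℕₚ.<-irrefl i≡2+i (ℕₚ.≤-trans (ℕₚ.n<1+n i) (ℕₚ.n≤1+n (suc i))))
      ... | yes _    | no _      = lemma₁ (onPath f m)
        where
        lemma₁ : ∀ x → 𝟙 true * x ≡ 𝟙 true * x + 𝟙 false * x
        lemma₁ = solve-∀ ℚ-ring
      ... | no _     | yes _     = lemma₂ (onPath f m)
        where
        lemma₂ : ∀ x → 𝟙 true * x ≡ 𝟙 false * x + 𝟙 true * x
        lemma₂ = solve-∀ ℚ-ring
      ... | no _     | no _      = lemma₃ (onPath f m)
        where
        lemma₃ : ∀ x → 𝟙 false * x ≡ 𝟙 false * x + 𝟙 false * x
        lemma₃ = solve-∀ ℚ-ring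
      path-block : sumFin (suc d) (λ j′ → 𝟙 (⌊ toℕ j′ ≟ suc i ⌋ ∨ ⌊ i ≟ suc (toℕ j′) ⌋) * f (pv j′)) ≡ pathSum i (onPath f)
      path-block = begin
        sumFin (suc d) (λ j′ → 𝟙 (⌊ toℕ j′ ≟ suc i ⌋ ∨ ⌊ i ≟ suc (toℕ j′) ⌋) * f (pv j′))
          ≡⟨ sumFin-pv (λ m → 𝟙 (⌊ m ≟ suc i ⌋ ∨ ⌊ i ≟ suc m ⌋)) f ⟩
        sumFrom 0 (suc d) (λ m → 𝟙 (⌊ m ≟ suc i ⌋ ∨ ⌊ i ≟ suc m ⌋) * onPath f m)
          ≡⟨ sumFrom-cong 0 (suc d) (λ m _ → 𝟙-∨ m) ⟩
        sumFrom 0 (suc d) (λ m → 𝟙 ⌊ m ≟ suc i ⌋ * onPath f m + 𝟙 ⌊ i ≟ suc m ⌋ * onPath f m)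
          ≡⟨ sumFrom-+ 0 (suc d) (λ m → 𝟙 ⌊ m ≟ suc i ⌋ * onPath f m) (λ m → 𝟙 ⌊ i ≟ suc m ⌋ * onPath f m) ⟩
        pathSum i (onPath f) ∎
        where open ≡-Reasoning

    private
      sumNbr-attached : ∀ q f → q ≤ d →
        sumFin (suc d) (λ j → 𝟙 ⌊ toℕ j ≟ q ⌋ * f (pv j)) + sumFin l (λ j → 𝟙 false * f (lf j))
          + sumFin r' (λ j → 𝟙 false * f (rt j)) + 𝟙 false * f zz ≡ onPath f q
      sumNbr-attached q f q≤d = begin
        sumFin (suc d) (λ j → 𝟙 ⌊ toℕ j ≟ q ⌋ * f (pv j)) + sumFin l (λ j → 𝟙 false * f (lf j))
          + sumFin r' (λ j → 𝟙 false * f (rt j)) + 𝟙 false * f zz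
          ≡⟨ +-cong₄ (sumFin-pv (λ m → 𝟙 ⌊ m ≟ q ⌋) f) (sumFin-𝟙-false l (f ∘ lf)) (sumFin-𝟙-false r' (f ∘ rt)) (𝟙-false (f zz)) ⟩
        sumFrom 0 (suc d) (λ m → 𝟙 ⌊ m ≟ q ⌋ * onPath f m) + 0ℚ + 0ℚ + 0ℚ
          ≡⟨ trans (lemma _) (sumFrom-select 0 (suc d) q (onPath f) z≤n (s≤s q≤d)) ⟩
        onPath f q ∎
        where
        open ≡-Reasoning
        lemma : ∀ x → x + 0ℚ + 0ℚ + 0ℚ ≡ x
        lemma = solve-∀ ℚ-ring

    sumNbr-pendant : ∀ {u} → Pendant u → ∀ f → sumNbr u f ≡ onPath f (position u)
    sumNbr-pendant (lf _) f = sumNbr-attached 1 f (s≤s z≤n)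
    sumNbr-pendant (rt _) f = sumNbr-attached (d ∸ 1) f (ℕₚ.n≤1+n _)
    sumNbr-pendant zz     f = sumNbr-attached k f k≤d

    deg-pendant : ∀ {u} → Pendant u → deg u ≡ 1ℚ
    deg-pendant p = sumNbr-pendant p (λ _ → ℕ→ℚ 1)

    deg-pv : ∀ j → deg (pv j) ≡ pathDegree (toℕ j) + pendants (toℕ j)
    deg-pv j = begin
      deg (pv j)
        ≡⟨ sumNbr-pv j (λ _ → ℕ→ℚ 1) ⟩
      pathDegree i + 𝟙 ⌊ i ≟ 1 ⌋ * sumFin l (λ _ → ℕ→ℚ 1) + 𝟙 ⌊ i ≟ d ∸ 1 ⌋ * sumFin r' (λ _ → ℕ→ℚ 1) + 𝟙 ⌊ i ≟ k ⌋ * ℕ→ℚ 1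
        ≡⟨ cong₂ (λ a b → pathDegree i + 𝟙 ⌊ i ≟ 1 ⌋ * a + 𝟙 ⌊ i ≟ d ∸ 1 ⌋ * b + 𝟙 ⌊ i ≟ k ⌋ * ℕ→ℚ 1) (sumFin-const l (ℕ→ℚ 1)) (sumFin-const r' (ℕ→ℚ 1)) ⟩
      pathDegree i + 𝟙 ⌊ i ≟ 1 ⌋ * (ℕ→ℚ l * ℕ→ℚ 1) + 𝟙 ⌊ i ≟ d ∸ 1 ⌋ * (ℕ→ℚ r' * ℕ→ℚ 1) + 𝟙 ⌊ i ≟ k ⌋ * ℕ→ℚ 1
        ≡⟨ lemma (pathDegree i) (𝟙 ⌊ i ≟ 1 ⌋) (𝟙 ⌊ i ≟ d ∸ 1 ⌋) (𝟙 ⌊ i ≟ k ⌋) (ℕ→ℚ l) (ℕ→ℚ r') ⟩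
      pathDegree i + pendants i ∎
      where
      open ≡-Reasoning
      i = toℕ j
      lemma : ∀ p a b c x y → p + a * (x * ℕ→ℚ 1) + b * (y * ℕ→ℚ 1) + c * ℕ→ℚ 1 ≡ p + (a * x + b * y + c)
      lemma = solve-∀ ℚ-ring

    sumNbr-pv-pendantwise : ∀ j f (F : ℕ → ℚ) → (∀ {u} → Pendant u → f u ≡ F (position u)) →
      let i = toℕ j in sumNbr (pv j) f ≡ pathSum i (onPath f) + pendants i * F i
    sumNbr-pv-pendantwise j f F f≡F = begin
      sumNbr (pv j) f
        ≡⟨ sumNbr-pv j f ⟩
      Σpath + 𝟙 ⌊ i ≟ 1 ⌋ * sumFin l (f ∘ lf) + 𝟙 ⌊ i ≟ d ∸ 1 ⌋ * sumFin r' (f ∘ rt) + 𝟙 ⌊ i ≟ k ⌋ * f zz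
        ≡⟨ cong₂ _+_ (cong₂ (λ a b → Σpath + a + b)
                       (trans (cong (𝟙 ⌊ i ≟ 1 ⌋ *_) (trans (sumFin-cong l (f≡F ∘ lf)) (sumFin-const l (F 1)))) (𝟙-≟-subst i 1 (λ m → ℕ→ℚ l * F m)))
                       (trans (cong (𝟙 ⌊ i ≟ d ∸ 1 ⌋ *_) (trans (sumFin-cong r' (f≡F ∘ rt)) (sumFin-const r' (F (d ∸ 1))))) (𝟙-≟-subst i (d ∸ 1) (λ m → ℕ→ℚ r' * F m))))
                     (trans (cong (𝟙 ⌊ i ≟ k ⌋ *_) (f≡F zz)) (𝟙-≟-subst i k F)) ⟩
      Σpath + 𝟙 ⌊ i ≟ 1 ⌋ * (ℕ→ℚ l * F i) + 𝟙 ⌊ i ≟ d ∸ 1 ⌋ * (ℕ→ℚ r' * F i) + 𝟙 ⌊ i ≟ k ⌋ * F i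
        ≡⟨ lemma Σpath (𝟙 ⌊ i ≟ 1 ⌋) (𝟙 ⌊ i ≟ d ∸ 1 ⌋) (𝟙 ⌊ i ≟ k ⌋) (ℕ→ℚ l) (ℕ→ℚ r') (F i) ⟩
      Σpath + pendants i * F i ∎
      where
      open ≡-Reasoning
      i = toℕ j
      Σpath = pathSum i (onPath f)
      lemma : ∀ s a b c x y z → s + a * (x * z) + b * (y * z) + c * z ≡ s + (a * x + b * y + c) * z
      lemma = solve-∀ ℚ-ring

    -- Distances, and Tetali's formula for the hitting times
    height : V → ℕ
    height (pv _) = 0
    height _      = 1

    height-pendant : ∀ {u} → Pendant u → height u ≡ 1
    height-pendant (lf _) = refl
    height-pendant (rt _) = refl
    height-pendant zz     = refl

    -- A vertex w lies at height 0 or 1 above the path vertex with index position w, so the tree distance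
    -- is |position w - position x| + height w + height x for w ≢ x; the δ-term makes dist x x = 0.
    dist₀ dist : V → V → ℚ
    dist₀ w x = ℕ→ℚ (∣ position w - position x ∣ ℕ.+ height w ℕ.+ height x)
    dist  w x = dist₀ w x - δ w x * ℕ→ℚ (2 ℕ.* height x)

    dist-self : ∀ x → dist x x ≡ 0ℚ
    dist-self x = begin
      ℕ→ℚ (∣ position x - position x ∣ ℕ.+ h ℕ.+ h) - δ x x * ℕ→ℚ (2 ℕ.* h)
        ≡⟨ cong₂ (λ a b → ℕ→ℚ (a ℕ.+ h ℕ.+ h) - b * ℕ→ℚ (2 ℕ.* h)) (ℕₚ.∣n-n∣≡0 (position x)) (δ-refl x) ⟩
      ℕ→ℚ (0 ℕ.+ h ℕ.+ h) - 1ℚ * ℕ→ℚ (2 ℕ.* h)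
        ≡⟨ cong (λ n → ℕ→ℚ n - 1ℚ * ℕ→ℚ (2 ℕ.* h)) (double h) ⟩
      ℕ→ℚ (2 ℕ.* h) - 1ℚ * ℕ→ℚ (2 ℕ.* h)
        ≡⟨ lemma (ℕ→ℚ (2 ℕ.* h)) ⟩
      0ℚ ∎
      where
      open ≡-Reasoning
      h = height x
      double : ∀ h → 0 ℕ.+ h ℕ.+ h ≡ 2 ℕ.* h
      double = ℕ-Ring.solve-∀
      lemma : ∀ y → y - 1ℚ * y ≡ 0ℚ
      lemma = solve-∀ ℚ-ring

    dist₀-pv : ∀ j x → dist₀ (pv j) x ≡ ℕ→ℚ ∣ toℕ j - position x ∣ + ℕ→ℚ (height x)
    dist₀-pv j x = trans (ℕ→ℚ-+₃ ∣ toℕ j - position x ∣ 0 (height x)) (cong (_+ ℕ→ℚ (height x)) (ℚₚ.+-identityʳ (ℕ→ℚ ∣ toℕ j - position x ∣)))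

    δ-pv-height : ∀ j x → δ (pv j) x * ℕ→ℚ (height x) ≡ 0ℚ
    δ-pv-height j x = trans (δ-subst (pv j) x (ℕ→ℚ ∘ height)) (ℚₚ.*-zeroʳ (δ (pv j) x))

    dist-pv : ∀ j x → dist (pv j) x ≡ ℕ→ℚ ∣ toℕ j - position x ∣ + ℕ→ℚ (height x)
    dist-pv j x = begin
      dist₀ (pv j) x - δ (pv j) x * ℕ→ℚ (2 ℕ.* height x)
        ≡⟨ cong₂ (λ a b → a - δ (pv j) x * b) (dist₀-pv j x) (ℕ→ℚ-* 2 (height x)) ⟩
      ℕ→ℚ ∣ toℕ j - position x ∣ + ℕ→ℚ (height x) - δ (pv j) x * (ℕ→ℚ 2 * ℕ→ℚ (height x))
        ≡⟨ lemma (ℕ→ℚ ∣ toℕ j - position x ∣) (ℕ→ℚ (height x)) (δ (pv j) x) (ℕ→ℚ (height x)) (δ-pv-height j x) ⟩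
      ℕ→ℚ ∣ toℕ j - position x ∣ + ℕ→ℚ (height x) ∎
      where
      open ≡-Reasoning
      lemma : ∀ a h e y → e * y ≡ 0ℚ → a + h - e * (ℕ→ℚ 2 * y) ≡ a + h
      lemma a h e y ey≡0 = trans (cong (λ z → a + h - z) (trans (lemma′ e y) (cong (ℕ→ℚ 2 *_) ey≡0)))
                                 (trans (cong (λ z → a + h - z) (ℚₚ.*-zeroʳ (ℕ→ℚ 2))) (lemma″ (a + h)))
        where
        lemma′ : ∀ e y → e * (ℕ→ℚ 2 * y) ≡ ℕ→ℚ 2 * (e * y)
        lemma′ = solve-∀ ℚ-ring
        lemma″ : ∀ z → z - 0ℚ ≡ z
        lemma″ = solve-∀ ℚ-ring

    dist₀-pendant : ∀ {u} → Pendant u → ∀ x → dist₀ u x ≡ ℕ→ℚ ∣ position u - position x ∣ + 1ℚ + ℕ→ℚ (height x)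
    dist₀-pendant {u} p x = trans (cong (λ h → ℕ→ℚ (∣ position u - position x ∣ ℕ.+ h ℕ.+ height x)) (height-pendant p))
                                  (ℕ→ℚ-+₃ ∣ position u - position x ∣ 1 (height x))

    dist-pendant : ∀ {u} → Pendant u → ∀ x → dist u x ≡ ℕ→ℚ ∣ position u - position x ∣ + 1ℚ + ℕ→ℚ (height x) - ℕ→ℚ 2 * δ u x
    dist-pendant {u} p x = cong₂ _-_ (dist₀-pendant p x) (begin
      δ u x * ℕ→ℚ (2 ℕ.* height x)  ≡⟨ δ-subst u x (λ y → ℕ→ℚ (2 ℕ.* height y)) ⟩
      δ u x * ℕ→ℚ (2 ℕ.* height u)  ≡⟨ cong (λ h → δ u x * ℕ→ℚ (2 ℕ.* h)) (height-pendant p) ⟩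
      δ u x * ℕ→ℚ 2                 ≡⟨ ℚₚ.*-comm (δ u x) (ℕ→ℚ 2) ⟩
      ℕ→ℚ 2 * δ u x                 ∎)
      where open ≡-Reasoning

    sumNbr-dist : ∀ u x → sumNbr u (λ w → dist w x) ≡ sumNbr u (λ w → dist₀ w x) - ind (adj u x) * ℕ→ℚ (2 ℕ.* height x)
    sumNbr-dist u x = begin
      sumNbr u (λ w → dist w x)
        ≡⟨ sumNbr-cong u (λ w → lemma (dist₀ w x) (δ w x) c) ⟩
      sumNbr u (λ w → dist₀ w x + (- 1ℚ) * (δ w x * c))
        ≡⟨ sumNbr-+ u (λ w → dist₀ w x) (λ w → (- 1ℚ) * (δ w x * c)) ⟩
      sumNbr u (λ w → dist₀ w x) + sumNbr u (λ w → (- 1ℚ) * (δ w x * c))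
        ≡⟨ cong (sumNbr u (λ w → dist₀ w x) +_) (trans (sumNbr-*ˡ u (- 1ℚ) (λ w → δ w x * c)) (cong ((- 1ℚ) *_) (sumNbr-δ u x c))) ⟩
      sumNbr u (λ w → dist₀ w x) + (- 1ℚ) * (ind (adj u x) * c)
        ≡⟨ lemma′ (sumNbr u (λ w → dist₀ w x)) (ind (adj u x)) c ⟩
      sumNbr u (λ w → dist₀ w x) - ind (adj u x) * c ∎
      where
      open ≡-Reasoning
      c = ℕ→ℚ (2 ℕ.* height x)
      lemma : ∀ a e c → a - e * c ≡ a + (- 1ℚ) * (e * c)
      lemma = solve-∀ ℚ-ring
      lemma′ : ∀ s a c → s + (- 1ℚ) * (a * c) ≡ s - a * c
      lemma′ = solve-∀ ℚ-ring

    𝟙-position : ∀ j x → 𝟙 ⌊ toℕ j ≟ position x ⌋ ≡ δ (pv j) x + ℕ→ℚ (height x) * ind (adj (pv j) x)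
    𝟙-position j (pv j′) = sym (trans (cong (δ (pv j) (pv j′) +_) (ℚₚ.*-zeroˡ (ind (adj (pv j) (pv j′))))) (trans (ℚₚ.+-identityʳ _) (pv-case j j′)))
      where
      pv-case : ∀ j j′ → δ (pv j) (pv j′) ≡ 𝟙 ⌊ toℕ j ≟ toℕ j′ ⌋
      pv-case j j′ with j Finₚ.≟ j′
      ... | yes refl = cong 𝟙 (sym (≟-refl (toℕ j)))
      ... | no j≢j′  = cong 𝟙 (sym (≢⇒≟-false (j≢j′ ∘ Finₚ.toℕ-injective)))
    𝟙-position j (lf _) = sym (lemma (𝟙 ⌊ toℕ j ≟ 1 ⌋))
      where
      lemma : ∀ e → 0ℚ + ℕ→ℚ 1 * e ≡ e
      lemma = solve-∀ ℚ-ring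
    𝟙-position j (rt _) = sym (lemma (𝟙 ⌊ toℕ j ≟ d ∸ 1 ⌋))
      where
      lemma : ∀ e → 0ℚ + ℕ→ℚ 1 * e ≡ e
      lemma = solve-∀ ℚ-ring
    𝟙-position j zz     = sym (lemma (𝟙 ⌊ toℕ j ≟ k ⌋))
      where
      lemma : ∀ e → 0ℚ + ℕ→ℚ 1 * e ≡ e
      lemma = solve-∀ ℚ-ring

    dist-laplacian-pendant : ∀ {u} → Pendant u → ∀ x →
      sumNbr u (λ w → dist w x) ≡ deg u * dist u x + deg u - ℕ→ℚ 2 + ℕ→ℚ 2 * δ u x
    dist-laplacian-pendant {u} p x = begin
      sumNbr u (λ w → dist w x)
        ≡⟨ sumNbr-pendant p (λ w → dist w x) ⟩
      dist (pv (clamp d q)) x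
        ≡⟨ dist-pv (clamp d q) x ⟩
      ℕ→ℚ ∣ toℕ (clamp d q) - position x ∣ + h
        ≡⟨ cong (λ m → ℕ→ℚ ∣ m - position x ∣ + h) (toℕ-clamp d q (position≤d u)) ⟩
      ℕ→ℚ ∣ q - position x ∣ + h
        ≡⟨ lemma (ℕ→ℚ ∣ q - position x ∣) h (δ u x) ⟩
      1ℚ * (ℕ→ℚ ∣ q - position x ∣ + 1ℚ + h - ℕ→ℚ 2 * δ u x) + 1ℚ - ℕ→ℚ 2 + ℕ→ℚ 2 * δ u x
        ≡⟨ cong₂ (λ Δ D → Δ * D + Δ - ℕ→ℚ 2 + ℕ→ℚ 2 * δ u x) (sym (deg-pendant p)) (sym (dist-pendant p x)) ⟩
      deg u * dist u x + deg u - ℕ→ℚ 2 + ℕ→ℚ 2 * δ u x ∎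
      where
      open ≡-Reasoning
      q = position u
      h = ℕ→ℚ (height x)
      lemma : ∀ a h e → a + h ≡ 1ℚ * (a + 1ℚ + h - ℕ→ℚ 2 * e) + 1ℚ - ℕ→ℚ 2 + ℕ→ℚ 2 * e
      lemma = solve-∀ ℚ-ring

    dist-laplacian-pv : ∀ j x → sumNbr (pv j) (λ w → dist w x) ≡ deg (pv j) * dist (pv j) x + deg (pv j) - ℕ→ℚ 2 + ℕ→ℚ 2 * δ (pv j) x
    dist-laplacian-pv j x = begin
      sumNbr (pv j) (λ w → dist w x)
        ≡⟨ sumNbr-dist (pv j) x ⟩
      sumNbr (pv j) (λ w → dist₀ w x) - a * ℕ→ℚ (2 ℕ.* height x)
        ≡⟨ cong₂ (λ s t → s - a * t) (sumNbr-pv-pendantwise j (λ w → dist₀ w x) (λ m → ℕ→ℚ ∣ m - p ∣ + 1ℚ + h) (λ p′ → dist₀-pendant p′ x))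
                                     (ℕ→ℚ-* 2 (height x)) ⟩
      pathSum i (onPath (λ w → dist₀ w x)) + c * (A + 1ℚ + h) - a * (ℕ→ℚ 2 * h)
        ≡⟨ cong (λ s → s + c * (A + 1ℚ + h) - a * (ℕ→ℚ 2 * h))
                (trans (pathSum-cong i onPath-dist₀) (pathSum-distance i p h (position≤d (pv j)) (position≤d x))) ⟩
      (P * (A + 1ℚ + h) - ℕ→ℚ 2 + ℕ→ℚ 2 * 𝟙 ⌊ i ≟ p ⌋) + c * (A + 1ℚ + h) - a * (ℕ→ℚ 2 * h)
        ≡⟨ cong (λ e → (P * (A + 1ℚ + h) - ℕ→ℚ 2 + ℕ→ℚ 2 * e) + c * (A + 1ℚ + h) - a * (ℕ→ℚ 2 * h)) (𝟙-position j x) ⟩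
      (P * (A + 1ℚ + h) - ℕ→ℚ 2 + ℕ→ℚ 2 * (δ (pv j) x + h * a)) + c * (A + 1ℚ + h) - a * (ℕ→ℚ 2 * h)
        ≡⟨ lemma P c A h a (δ (pv j) x) ⟩
      (P + c) * (A + h) + (P + c) - ℕ→ℚ 2 + ℕ→ℚ 2 * δ (pv j) x
        ≡⟨ cong₂ (λ Δ D → Δ * D + Δ - ℕ→ℚ 2 + ℕ→ℚ 2 * δ (pv j) x) (sym (deg-pv j)) (sym (dist-pv j x)) ⟩
      deg (pv j) * dist (pv j) x + deg (pv j) - ℕ→ℚ 2 + ℕ→ℚ 2 * δ (pv j) x ∎
      where
      open ≡-Reasoning
      i = toℕ j
      p = position x
      h = ℕ→ℚ (height x)
      A = ℕ→ℚ ∣ i - p ∣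
      a = ind (adj (pv j) x)
      P = pathDegree i
      c = pendants i
      onPath-dist₀ : ∀ m → m ≤ d → onPath (λ w → dist₀ w x) m ≡ ℕ→ℚ ∣ m - p ∣ + h
      onPath-dist₀ m m≤d = trans (dist₀-pv (clamp d m) x) (cong (λ n → ℕ→ℚ ∣ n - p ∣ + h) (toℕ-clamp d m m≤d))
      lemma : ∀ P c A h a e → (P * (A + 1ℚ + h) - ℕ→ℚ 2 + ℕ→ℚ 2 * (e + h * a)) + c * (A + 1ℚ + h) - a * (ℕ→ℚ 2 * h)
                              ≡ (P + c) * (A + h) + (P + c) - ℕ→ℚ 2 + ℕ→ℚ 2 * e
      lemma = solve-∀ ℚ-ring

    dist-laplacian : ∀ u x → sumNbr u (λ w → dist w x) ≡ deg u * dist u x + deg u - ℕ→ℚ 2 + ℕ→ℚ 2 * δ u x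
    dist-laplacian (pv j) = dist-laplacian-pv j
    dist-laplacian (lf j) = dist-laplacian-pendant (lf j)
    dist-laplacian (rt j) = dist-laplacian-pendant (rt j)
    dist-laplacian zz     = dist-laplacian-pendant zz

    totalDegree : ℚ
    totalDegree = sumV deg

    Φ : V → ℚ
    Φ u = sumV (λ x → deg x * dist u x)

    Φ-laplacian : ∀ u → sumNbr u Φ ≡ deg u * Φ u + ((deg u - ℕ→ℚ 2) * totalDegree + ℕ→ℚ 2 * deg u)
    Φ-laplacian u = begin
      sumNbr u Φ
        ≡⟨ sumNbr-comm u (λ w x → deg x * dist w x) ⟩
      sumV (λ x → sumNbr u (λ w → deg x * dist w x))
        ≡⟨ sumV-cong (λ x → trans (sumNbr-*ˡ u (deg x) (λ w → dist w x)) (cong (deg x *_) (dist-laplacian u x))) ⟩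
      sumV (λ x → deg x * (deg u * dist u x + deg u - ℕ→ℚ 2 + ℕ→ℚ 2 * δ u x))
        ≡⟨ sumV-cong (λ x → trans (cong (λ e → deg x * (deg u * dist u x + deg u - ℕ→ℚ 2 + ℕ→ℚ 2 * e)) (δ-comm u x))
                                  (lemma (deg x) (deg u) (dist u x) (δ x u))) ⟩
      sumV (λ x → deg u * (deg x * dist u x) + ((deg u - ℕ→ℚ 2) * deg x + ℕ→ℚ 2 * (δ x u * deg x)))
        ≡⟨ sumV-+ (λ x → deg u * (deg x * dist u x)) (λ x → (deg u - ℕ→ℚ 2) * deg x + ℕ→ℚ 2 * (δ x u * deg x)) ⟩
      sumV (λ x → deg u * (deg x * dist u x)) + sumV (λ x → (deg u - ℕ→ℚ 2) * deg x + ℕ→ℚ 2 * (δ x u * deg x))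
        ≡⟨ cong₂ _+_ (sumV-*ˡ (deg u) (λ x → deg x * dist u x))
                     (trans (sumV-+ (λ x → (deg u - ℕ→ℚ 2) * deg x) (λ x → ℕ→ℚ 2 * (δ x u * deg x)))
                            (cong₂ _+_ (sumV-*ˡ (deg u - ℕ→ℚ 2) deg)
                                       (trans (sumV-*ˡ (ℕ→ℚ 2) (λ x → δ x u * deg x)) (cong (ℕ→ℚ 2 *_) (sumV-select u deg))))) ⟩
      deg u * Φ u + ((deg u - ℕ→ℚ 2) * totalDegree + ℕ→ℚ 2 * deg u) ∎
      where
      open ≡-Reasoning
      lemma : ∀ a b c e → a * (b * c + b - ℕ→ℚ 2 + ℕ→ℚ 2 * e) ≡ b * (a * c) + ((b - ℕ→ℚ 2) * a + ℕ→ℚ 2 * (e * a))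
      lemma = solve-∀ ℚ-ring

    -- Tetali's formula ½ Σₓ deg x · (dist u v + dist v x − dist u x); Φ v − Φ u collects the last two terms.
    hittingTime : V → V → ℚ
    hittingTime u v = ½ * (totalDegree * dist u v + Φ v - Φ u)

    hittingTime-equation : ∀ v u → u ≢ v → deg u * hittingTime u v ≡ deg u + sumNbr u (λ w → hittingTime w v)
    hittingTime-equation v u u≢v = sym (begin
      deg u + sumNbr u (λ w → hittingTime w v)
        ≡⟨ cong (deg u +_) (sumNbr-cong u (λ w → expand ½ S (dist w v) (Φ v) (Φ w))) ⟩
      deg u + sumNbr u (λ w → (½ * S) * dist w v + (½ * Φ v + (- ½) * Φ w))
        ≡⟨ cong (deg u +_) (trans (sumNbr-+ u (λ w → (½ * S) * dist w v) (λ w → ½ * Φ v + (- ½) * Φ w))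
             (cong₂ _+_ (sumNbr-*ˡ u (½ * S) (λ w → dist w v))
                        (trans (sumNbr-+ u (λ _ → ½ * Φ v) (λ w → (- ½) * Φ w)) (cong₂ _+_ (sumNbr-const u (½ * Φ v)) (sumNbr-*ˡ u (- ½) Φ))))) ⟩
      deg u + ((½ * S) * sumNbr u (λ w → dist w v) + (deg u * (½ * Φ v) + (- ½) * sumNbr u Φ))
        ≡⟨ cong₂ (λ a b → deg u + ((½ * S) * a + (deg u * (½ * Φ v) + (- ½) * b)))
                 (trans (dist-laplacian u v) (cong (λ e → deg u * dist u v + deg u - ℕ→ℚ 2 + ℕ→ℚ 2 * e) (δ-≢ u≢v)))
                 (Φ-laplacian u) ⟩
      deg u + ((½ * S) * (deg u * dist u v + deg u - ℕ→ℚ 2 + ℕ→ℚ 2 * 0ℚ)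
               + (deg u * (½ * Φ v) + (- ½) * (deg u * Φ u + ((deg u - ℕ→ℚ 2) * S + ℕ→ℚ 2 * deg u))))
        ≡⟨ collect (deg u) S (dist u v) (Φ v) (Φ u) ⟩
      deg u * hittingTime u v ∎)
      where
      open ≡-Reasoning
      S = totalDegree
      expand : ∀ h s δ a b → h * (s * δ + a - b) ≡ (h * s) * δ + (h * a + (- h) * b)
      expand = solve-∀ ℚ-ring
      collect : ∀ g s δ a b → g + ((½ * s) * (g * δ + g - ℕ→ℚ 2 + ℕ→ℚ 2 * 0ℚ) + (g * (½ * a) + (- ½) * (g * b + ((g - ℕ→ℚ 2) * s + ℕ→ℚ 2 * g))))
                              ≡ g * (½ * (s * δ + a - b))
      collect = solve-∀ ℚ-ring

    hittingTime-isHittingTime : IsHittingTime hittingTime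
    hittingTime-isHittingTime v = hittingTime-self , λ u u≢v → hittingTime-equation v u u≢v
      where
      hittingTime-self : hittingTime v v ≡ 0ℚ
      hittingTime-self = trans (cong (λ δ → ½ * (totalDegree * δ + Φ v - Φ v)) (dist-self v)) (lemma totalDegree (Φ v))
        where
        lemma : ∀ s a → ½ * (s * 0ℚ + a - a) ≡ 0ℚ
        lemma = solve-∀ ℚ-ring

    -- Joining times from the two ends of the path
    module HittingTimesTo (j₀ : Fin (suc d)) (H : V → V → ℚ) (isH : IsHittingTime H) where

      h : V → ℚ
      h w = H w (pv j₀)

      g : ℕ → ℚ
      g = onPath h

      h-pv : ∀ j → h (pv j) ≡ g (toℕ j)
      h-pv j = cong (λ j′ → h (pv j′)) (sym (clamp-toℕ d j))

      pendant-value : ∀ {u} → Pendant u → h u ≡ 1ℚ + g (position u)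
      pendant-value {u} p = begin
        h u                  ≡⟨ sym (ℚₚ.*-identityˡ (h u)) ⟩
        1ℚ * h u             ≡⟨ cong (_* h u) (sym (deg-pendant p)) ⟩
        deg u * h u          ≡⟨ proj₂ (isH (pv j₀)) u (pendant≢pv p) ⟩
        deg u + sumNbr u h   ≡⟨ cong₂ _+_ (deg-pendant p) (sumNbr-pendant p h) ⟩
        1ℚ + g (position u)  ∎
        where
        open ≡-Reasoning
        pendant≢pv : ∀ {u} → Pendant u → u ≢ pv j₀
        pendant≢pv (lf _) ()
        pendant≢pv (rt _) ()
        pendant≢pv zz     ()

      path-equation : ∀ i → i ≤ d → i ≢ toℕ j₀ →
        (pathDegree i + pendants i) * g i ≡ (pathDegree i + pendants i) + (pathSum i g + pendants i * (1ℚ + g i))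
      path-equation i i≤d i≢j₀ = subst (λ m → (pathDegree m + pendants m) * g m ≡ (pathDegree m + pendants m) + (pathSum m g + pendants m * (1ℚ + g m)))
                                      (toℕ-clamp d i i≤d) (begin
        (pathDegree m + pendants m) * g m
          ≡⟨ cong₂ _*_ (sym (deg-pv j)) (sym (h-pv j)) ⟩
        deg (pv j) * h (pv j)
          ≡⟨ proj₂ (isH (pv j₀)) (pv j) (pv-clamp-≢ i j₀ i≤d i≢j₀) ⟩
        deg (pv j) + sumNbr (pv j) h
          ≡⟨ cong₂ _+_ (deg-pv j) (sumNbr-pv-pendantwise j h (λ m → 1ℚ + g m) pendant-value) ⟩
        (pathDegree m + pendants m) + (pathSum m g + pendants m * (1ℚ + g m)) ∎)
        where
        open ≡-Reasoning
        j = clamp d i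
        m = toℕ j

      J-expansion : J H (pv j₀) ≡ sumFrom 0 (suc d) (λ m → (pathDegree m + ℕ→ℚ 2 * pendants m) * g m) + ℕ→ℚ (l ℕ.+ r' ℕ.+ 1)
      J-expansion = begin
        J H (pv j₀)
          ≡⟨ +-cong₄ path-block lf-block rt-block (degree-one zz) ⟩
        Σ[P+c]g + ℕ→ℚ l * (1ℚ + g 1) + ℕ→ℚ r' * (1ℚ + g (d ∸ 1)) + (1ℚ + g k)
          ≡⟨ lemma Σ[P+c]g (ℕ→ℚ l) (ℕ→ℚ r') (g 1) (g (d ∸ 1)) (g k) ⟩
        Σ[P+c]g + (ℕ→ℚ l * g 1 + ℕ→ℚ r' * g (d ∸ 1) + g k) + (ℕ→ℚ l + ℕ→ℚ r' + ℕ→ℚ 1)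
          ≡⟨ cong₂ (λ a b → Σ[P+c]g + a + b) (sym (sumFrom-pendants g)) (sym (trans (ℕ→ℚ-+ (l ℕ.+ r') 1) (cong (_+ ℕ→ℚ 1) (ℕ→ℚ-+ l r')))) ⟩
        Σ[P+c]g + sumFrom 0 (suc d) (λ m → pendants m * g m) + ℕ→ℚ (l ℕ.+ r' ℕ.+ 1)
          ≡⟨ cong (_+ ℕ→ℚ (l ℕ.+ r' ℕ.+ 1)) (sym (trans (sumFrom-cong 0 (suc d) (λ m _ → split-weight m))
                                                   (sumFrom-+ 0 (suc d) (λ m → (pathDegree m + pendants m) * g m) (λ m → pendants m * g m)))) ⟩
        sumFrom 0 (suc d) (λ m → (pathDegree m + ℕ→ℚ 2 * pendants m) * g m) + ℕ→ℚ (l ℕ.+ r' ℕ.+ 1) ∎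
        where
        open ≡-Reasoning
        Σ[P+c]g = sumFrom 0 (suc d) (λ m → (pathDegree m + pendants m) * g m)
        path-block : sumFin (suc d) (λ j → deg (pv j) * h (pv j)) ≡ Σ[P+c]g
        path-block = trans (sumFin-cong (suc d) (λ j → cong₂ _*_ (deg-pv j) (h-pv j)))
                           (sumFin≡sumFrom (suc d) (λ m → (pathDegree m + pendants m) * g m))
        degree-one : ∀ {u} → Pendant u → deg u * h u ≡ 1ℚ + g (position u)
        degree-one p = trans (cong₂ _*_ (deg-pendant p) (pendant-value p)) (ℚₚ.*-identityˡ _)
        lf-block : sumFin l (λ j → deg (lf j) * h (lf j)) ≡ ℕ→ℚ l * (1ℚ + g 1)
        lf-block = trans (sumFin-cong l (degree-one ∘ lf)) (sumFin-const l (1ℚ + g 1))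
        rt-block : sumFin r' (λ j → deg (rt j) * h (rt j)) ≡ ℕ→ℚ r' * (1ℚ + g (d ∸ 1))
        rt-block = trans (sumFin-cong r' (degree-one ∘ rt)) (sumFin-const r' (1ℚ + g (d ∸ 1)))
        split-weight : ∀ m → (pathDegree m + ℕ→ℚ 2 * pendants m) * g m ≡ (pathDegree m + pendants m) * g m + pendants m * g m
        split-weight m = lemma′ (pathDegree m) (pendants m) (g m)
          where
          lemma′ : ∀ p c y → (p + ℕ→ℚ 2 * c) * y ≡ (p + c) * y + c * y
          lemma′ = solve-∀ ℚ-ring
        lemma : ∀ s x y a b e → s + x * (1ℚ + a) + y * (1ℚ + b) + (1ℚ + e) ≡ s + (x * a + y * b + e) + (x + y + ℕ→ℚ 1)
        lemma = solve-∀ ℚ-ring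

      end-equation : ∀ i {S} → i ≤ d → i ≢ toℕ j₀ → pathDegree i ≡ 1ℚ → pathSum i g ≡ S →
        (1ℚ + pendants i) * g i ≡ (1ℚ + pendants i) + (S + pendants i * (1ℚ + g i))
      end-equation i i≤d i≢j₀ P≡1 Σ≡S = subst₂ (λ P S → (P + pendants i) * g i ≡ (P + pendants i) + (S + pendants i * (1ℚ + g i)))
        P≡1 Σ≡S (path-equation i i≤d i≢j₀)

      interior-equation : ∀ i {S} → 0 < i → i < d → i ≢ toℕ j₀ → pathSum i g ≡ S →
        (ℕ→ℚ 2 + pendants i) * g i ≡ (ℕ→ℚ 2 + pendants i) + (S + pendants i * (1ℚ + g i))
      interior-equation i 0<i i<d i≢j₀ Σ≡S = subst₂ (λ P S → (P + pendants i) * g i ≡ (P + pendants i) + (S + pendants i * (1ℚ + g i)))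
        (pathDegree-interior i 0<i i<d) Σ≡S (path-equation i (ℕₚ.<⇒≤ i<d) i≢j₀)

    private
      weights-at-zero : ∀ x y {z} → z ≡ 0ℚ → x * z ≡ y * z
      weights-at-zero x y refl = trans (ℚₚ.*-zeroʳ x) (sym (ℚₚ.*-zeroʳ y))

    module _ (H : V → V → ℚ) (isH : IsHittingTime H) where

      joiningTime-end : let X = partialSum (pathWeight pendants) in
        J H (pv (fromℕ d)) ≡ sumFrom 0 d (λ t → X t * X t) + ℕ→ℚ (l ℕ.+ r' ℕ.+ 1)
      joiningTime-end = begin
        J H (pv (fromℕ d))
          ≡⟨ J-expansion ⟩
        sumFrom 0 (suc d) (λ m → (pathDegree m + ℕ→ℚ 2 * pendants m) * g m) + ℕ→ℚ (l ℕ.+ r' ℕ.+ 1)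
          ≡⟨ cong (_+ ℕ→ℚ (l ℕ.+ r' ℕ.+ 1)) (sumFrom-cong 0 (suc d) weights) ⟩
        sumFrom 0 (suc d) (λ t → pathWeight pendants t * g t) + ℕ→ℚ (l ℕ.+ r' ℕ.+ 1)
          ≡⟨ cong (_+ ℕ→ℚ (l ℕ.+ r' ℕ.+ 1)) (summation-by-parts (pathWeight pendants) g d gaps g-d) ⟩
        sumFrom 0 d (λ t → X t * X t) + ℕ→ℚ (l ℕ.+ r' ℕ.+ 1) ∎
        where
        open ≡-Reasoning
        open HittingTimesTo (fromℕ d) H isH
        X = partialSum (pathWeight pendants)
        ≢d : ∀ {i} → i < d → i ≢ toℕ (fromℕ d)
        ≢d i<d i≡d = ℕₚ.<-irrefl (trans i≡d (Finₚ.toℕ-fromℕ d)) i<d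
        gaps : ∀ t → t < d → g t ≡ g (suc t) + X t
        gaps = hittingTime-gaps pendants g d
          (end-equation 0 z≤n (≢d (s≤s z≤n)) pathDegree-0 (pathSum-0 g))
          (λ t 1+t<d → interior-equation (suc t) (s≤s z≤n) 1+t<d (≢d 1+t<d) (pathSum-interior t g 1+t<d))
        g-d : g d ≡ 0ℚ
        g-d = trans (cong (λ j → h (pv j)) (clamp-fromℕ d)) (proj₁ (isH (pv (fromℕ d))))
        weights : ∀ t → t < suc d → (pathDegree t + ℕ→ℚ 2 * pendants t) * g t ≡ pathWeight pendants t * g t
        weights zero    _       = cong (λ P → (P + ℕ→ℚ 2 * pendants 0) * g 0) pathDegree-0
        weights (suc t) 1+t≤d with ℕₚ.m≤n⇒m<n∨m≡n (ℕₚ.≤-pred 1+t≤d)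
        ... | inj₁ 1+t<d = cong (λ P → (P + ℕ→ℚ 2 * pendants (suc t)) * g (suc t)) (pathDegree-interior (suc t) (s≤s z≤n) 1+t<d)
        ... | inj₂ refl  = weights-at-zero (pathDegree d + ℕ→ℚ 2 * pendants d) (pathWeight pendants d) g-d

      joiningTime-start : let X = partialSum (pathWeight (λ t → pendants (d ∸ t))) in
        J H (pv zero) ≡ sumFrom 0 d (λ t → X t * X t) + ℕ→ℚ (l ℕ.+ r' ℕ.+ 1)
      joiningTime-start = begin
        J H (pv zero)
          ≡⟨ J-expansion ⟩
        sumFrom 0 (suc d) (λ m → (pathDegree m + ℕ→ℚ 2 * pendants m) * g m) + ℕ→ℚ (l ℕ.+ r' ℕ.+ 1)
          ≡⟨ cong (_+ ℕ→ℚ (l ℕ.+ r' ℕ.+ 1)) (trans (sumFrom-reverse d (λ m → (pathDegree m + ℕ→ℚ 2 * pendants m) * g m)) (sumFrom-cong 0 (suc d) weights)) ⟩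
        sumFrom 0 (suc d) (λ t → pathWeight c t * G t) + ℕ→ℚ (l ℕ.+ r' ℕ.+ 1)
          ≡⟨ cong (_+ ℕ→ℚ (l ℕ.+ r' ℕ.+ 1)) (summation-by-parts (pathWeight c) G d gaps G-d) ⟩
        sumFrom 0 d (λ t → X t * X t) + ℕ→ℚ (l ℕ.+ r' ℕ.+ 1) ∎
        where
        open ≡-Reasoning
        open HittingTimesTo zero H isH
        c G : ℕ → ℚ
        c t = pendants (d ∸ t)
        G t = g (d ∸ t)
        X = partialSum (pathWeight c)
        0<d∸1+t : ∀ {t} → suc t < d → 0 < d ∸ suc t
        0<d∸1+t = ℕₚ.m<n⇒0<n∸m
        d∸1+t<d : ∀ {t} → suc t < d → d ∸ suc t < d
        d∸1+t<d 1+t<d = ℕₚ.∸-monoʳ-< (s≤s z≤n) (ℕₚ.<⇒≤ 1+t<d)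
        gaps : ∀ t → t < d → G t ≡ G (suc t) + X t
        gaps = hittingTime-gaps c G d
          (end-equation d ℕₚ.≤-refl (λ ()) pathDegree-d (pathSum-d g))
          (λ t 1+t<d → interior-equation (d ∸ suc t) (0<d∸1+t 1+t<d) (d∸1+t<d 1+t<d)
                                         (λ i≡0 → ℕₚ.<-irrefl (sym i≡0) (0<d∸1+t 1+t<d)) (pathSum-reversed t g 1+t<d))
        G-d : G d ≡ 0ℚ
        G-d = trans (cong g (ℕₚ.n∸n≡0 d)) (proj₁ (isH (pv zero)))
        weights : ∀ t → t < suc d → (pathDegree (d ∸ t) + ℕ→ℚ 2 * c t) * G t ≡ pathWeight c t * G t
        weights zero    _       = cong (λ P → (P + ℕ→ℚ 2 * c 0) * G 0) pathDegree-d
        weights (suc t) 1+t≤d with ℕₚ.m≤n⇒m<n∨m≡n (ℕₚ.≤-pred 1+t≤d)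
        ... | inj₁ 1+t<d = cong (λ P → (P + ℕ→ℚ 2 * c (suc t)) * G (suc t)) (pathDegree-interior (d ∸ suc t) (0<d∸1+t 1+t<d) (d∸1+t<d 1+t<d))
        ... | inj₂ refl  = weights-at-zero (pathDegree (d ∸ d) + ℕ→ℚ 2 * c d) (pathWeight c d) G-d

      joiningTime-end-closedForm :
        J H (pv (fromℕ d)) ≡ base n d + sumRange 1 (k ∸ 1) (oddSquare⁻ (suc l)) + sumRange k (d ∸ 2) (oddSquare⁺ (suc l))
      joiningTime-end-closedForm = trans joiningTime-end
        (sum-partialSum²-closedForm l r' k' (d' ∸ k') k d refl (cong (4 ℕ.+_) (sym (ℕₚ.m+[n∸m]≡n k'≤d')))
          pendants pendants-0 pendants-1 pendants-left pendants-k pendants-right pendants-d∸1)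

      joiningTime-start-closedForm :
        J H (pv zero) ≡ base n d + sumRange 1 (d ∸ k ∸ 1) (oddSquare⁻ (suc r')) + sumRange (d ∸ k) (d ∸ 2) (oddSquare⁺ (suc r'))
      joiningTime-start-closedForm = begin
        J H (pv zero)
          ≡⟨ joiningTime-start ⟩
        sumFrom 0 d (λ t → X t * X t) + ℕ→ℚ (l ℕ.+ r' ℕ.+ 1)
          ≡⟨ cong (λ m → sumFrom 0 d (λ t → X t * X t) + ℕ→ℚ (m ℕ.+ 1)) (ℕₚ.+-comm l r') ⟩
        sumFrom 0 d (λ t → X t * X t) + ℕ→ℚ (r' ℕ.+ l ℕ.+ 1)
          ≡⟨ sum-partialSum²-closedForm r' l (d' ∸ k') k' (d ∸ k) d (ℕₚ.+-∸-assoc 2 k'≤d') (cong (4 ℕ.+_) (sym (ℕₚ.m∸n+n≡m k'≤d')))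
               c pendants-d pendants-d∸1 pendants-reversed-left c-K pendants-reversed-right c-last ⟩
        base (suc r' ℕ.+ suc l ℕ.+ d) d + Σleft + Σright
          ≡⟨ cong (λ m → base (m ℕ.+ d) d + Σleft + Σright) (ℕₚ.+-comm (suc r') (suc l)) ⟩
        base n d + Σleft + Σright ∎
        where
        open ≡-Reasoning
        c : ℕ → ℚ
        c t = pendants (d ∸ t)
        X = partialSum (pathWeight c)
        Σleft = sumRange 1 (d ∸ k ∸ 1) (oddSquare⁻ (suc r'))
        Σright = sumRange (d ∸ k) (d ∸ 2) (oddSquare⁺ (suc r'))
        c-K : c (d ∸ k) ≡ 1ℚ
        c-K = trans (cong pendants (ℕₚ.m∸[m∸n]≡n k≤d)) pendants-k
        c-last : c (d ∸ 1) ≡ ℕ→ℚ l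
        c-last = trans (cong pendants (ℕₚ.m∸[m∸n]≡n {d} {1} (s≤s z≤n))) pendants-1

open import Data.Nat using (ℕ; suc; _+_; _*_; _∸_; _≤_; z≤n; s≤s)
open import Data.Fin using (zero; fromℕ)
open import Data.Product using (Σ; _×_; _,_)
open import Data.Rational using (ℚ) renaming (_+_ to _+ℚ_; _-_ to _-ℚ_)
open import Relation.Binary.PropositionalEquality using (_≡_)
open JoiningTimes using (module Broom)

lemma4p4 : (ℓ r d k : ℕ) → 1 ≤ ℓ → 1 ≤ r → 4 ≤ d → 2 ≤ k → k ≤ d ∸ 2 →
    let open NDB ℓ r d k
        n = ℓ + r + d
        base = ℕ→ℚ (4 * n * n + 9) -ℚ ℕ→ℚ (11 * n + d)
    in Σ (V → V → ℚ) IsHittingTime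
       × ((H : V → V → ℚ) → IsHittingTime H →
           (J H (pv zero) ≡ base
              +ℚ sumRange 1 (d ∸ k ∸ 1) (λ i → ℕ→ℚ ((2 * r + 2 * i ∸ 1) * (2 * r + 2 * i ∸ 1)))
              +ℚ sumRange (d ∸ k) (d ∸ 2) (λ i → ℕ→ℚ ((2 * r + 2 * i + 1) * (2 * r + 2 * i + 1))))
           × (J H (pv (fromℕ d)) ≡ base
              +ℚ sumRange 1 (k ∸ 1) (λ i → ℕ→ℚ ((2 * ℓ + 2 * i ∸ 1) * (2 * ℓ + 2 * i ∸ 1)))
              +ℚ sumRange k (d ∸ 2) (λ i → ℕ→ℚ ((2 * ℓ + 2 * i + 1) * (2 * ℓ + 2 * i + 1)))))
lemma4p4 (suc l) (suc r') (suc (suc (suc (suc d')))) (suc (suc k'))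
         (s≤s z≤n) (s≤s z≤n) (s≤s (s≤s (s≤s (s≤s z≤n)))) (s≤s (s≤s z≤n)) (s≤s (s≤s k'≤d')) =
  (hittingTime , hittingTime-isHittingTime) ,
  λ H isH → joiningTime-start-closedForm H isH , joiningTime-end-closedForm H isH
  where open Broom l r' d' k' k'≤d'
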